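{- For every integer $k\ge 0$, \[ j(k) = 4\ell(k) - 4\ell(k-2) + \ell(k-4), \qquad \ell(k) = \sum_{i=0}^{\infty} \frac{i+1}{2^{i+2}}\, j(k-2i), \] where $\ell(k) := \lim_{n\to\infty} P(2n-1-|S-S| = k)$ and $j(k) := \lim_{n\to\infty} P\big(2n-1-|S-S| = k \mid 0\in S,\ n-1\in S\big)$, with $S$ a uniformly random subset of $[n]$.
   Context: For a positive integer $n$, $[n] := \{0,1,\dots,n-1\}$, random subsets are uniform over all $2^n$ subsets, and $S-S := \{x-y : x,y\in S\}$. Both limits exist for every integer $k$; since $|S-S|\le 2n-1$, $\ell(k)=j(k)=0$ for negative $k$ (so the sum is finite). -}

module Defs where

open import Data.Bool using (Bool; true; false; _∧_; _∨_; if_then_else_)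
open import Data.Nat as ℕ using (ℕ; zero; suc; _≤_)
open import Data.Nat.Properties using (m^n≢0)
open import Data.Integer as ℤ using (ℤ; +_; -[1+_])
open import Data.Fin using (Fin; toℕ)
import Data.Fin
open import Data.Vec using (Vec; []; _∷_; lookup)
open import Data.List using (List; []; _∷_; _++_; map; concatMap; filterᵇ; length; allFin; upTo; foldr)
open import Data.Product using (∃-syntax)
open import Relation.Nullary using (does)
open import Data.Rational as ℚ using (ℚ; 0ℚ)

-- All 2^n subsets of [n] = {0,…,n-1}, as characteristic vectors (Data.Fin.Subset style).
subsets : (n : ℕ) → List (Vec Bool n)
subsets zero    = [] ∷ []
subsets (suc n) = map (false ∷_) (subsets n) ++ map (true ∷_) (subsets n)

_∈ˢ_ : ∀ {n} → Fin n → Vec Bool n → Bool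
i ∈ˢ S = lookup S i

inDiff : ∀ {n} → Vec Bool n → ℤ → Bool
inDiff {n} S d =
  foldr _∨_ false
    (concatMap (λ x → map (λ y → (x ∈ˢ S) ∧ (y ∈ˢ S)
                         ∧ does ((+ toℕ x) ℤ.- (+ toℕ y) ℤ.≟ d))
                      (allFin n))
               (allFin n))

-- all integers in [-n, n]; S - S ⊆ [-(n-1), n-1] so this contains every candidate
intRange : ℕ → List ℤ
intRange n = map (λ i → (+ i) ℤ.- (+ n)) (upTo (2 ℕ.* n ℕ.+ 1))

diffCard : ∀ {n} → Vec Bool n → ℕ
diffCard {n} S = length (filterᵇ (inDiff S) (intRange n))

stat : ∀ {n} → Vec Bool n → ℤ
stat {n} S = ((+ (2 ℕ.* n)) ℤ.- (+ 1)) ℤ.- (+ diffCard S)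

countStat : (n : ℕ) → ℤ → ℕ
countStat n k = length (filterᵇ (λ S → does (stat S ℤ.≟ k)) (subsets n))

ℓₙ : ℕ → ℤ → ℚ
ℓₙ n k = ℚ._/_ (+ countStat n k) (2 ℕ.^ n) {{m^n≢0 2 n}}

endpointsIn : ∀ {m} → Vec Bool (suc (suc m)) → Bool
endpointsIn {m} S = lookup S Data.Fin.zero ∧ lookup S (Data.Fin.fromℕ (suc m))

-- jₙ(k) for n = m + 2: P(2n-1-|S-S| = k | 0 ∈ S, n-1 ∈ S).
-- The conditioning event has exactly 2^m = 2^(n-2) elements.
jₙ₊₂ : ℕ → ℤ → ℚ
jₙ₊₂ m k = ℚ._/_ (+ length (filterᵇ (λ S → endpointsIn S ∧ does (stat S ℤ.≟ k)) (subsets (suc (suc m)))))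
                 (2 ℕ.^ m) {{m^n≢0 2 m}}

TendsToZero : (ℕ → ℚ) → Set
TendsToZero a = (ε : ℚ) → 0ℚ ℚ.< ε → ∃[ N ] ((n : ℕ) → N ≤ n → ℚ.∣ a n ∣ ℚ.< ε)

Σ≤ : ℕ → (ℕ → ℚ) → ℚ
Σ≤ k f = foldr (λ i acc → f i ℚ.+ acc) 0ℚ (upTo (suc k))

weight : ℕ → ℚ
weight i = ℚ._/_ (+ suc i) (2 ℕ.^ (2 ℕ.+ i)) {{m^n≢0 2 (2 ℕ.+ i)}}

-- Let ℓ#, f#, j# count the subsets of [n] (resp. those containing 0, resp. 0 and the last point)
-- with a given statistic. If the first (last) point is absent, the set is a translate of a subset of
-- a shorter interval and the statistic grows by exactly 2; hence
--   ℓ#ₙ₊₁(t) = ℓ#ₙ(t-2) + f#ₙ(t)   and   f#ₙ₊₁(t) = f#ₙ(t-2) + j#ₙ(t).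
-- Eliminating f# gives jₘ = 4ℓₘ₊₂(t) - 4ℓₘ₊₁(t-2) + ℓₘ(t-4) exactly, and unrolling both recursions
-- gives ℓₘ₊₂(t) = Σᵢ (i+1)/2^(i+2) jₘ₋ᵢ(t-2i) exactly for m ≥ t. Both limits then follow from the
-- convergence of jₘ(t) in m. For that, cut a set containing both ends into a prefix A, a middle M and
-- a suffix W with |A| = |W| = h. If every difference 1, …, h + |M| occurs, the statistic depends on A
-- and W only; and a difference d is missing with probability at most (7/8)^(n-d), because blocks at
-- distance d must then be disjoint. So jₘ(t) lies within 32 (7/8)^(h+2) of a number independent of
-- m ≥ 2h, and (jₘ(t))ₘ is Cauchy.

module Submission where

module Sums where

  open import Algebra.Properties.CommutativeSemigroup using (interchange)
  open import Data.Bool using (Bool; true; false; _∧_; _∨_; not)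
  open import Data.Bool.Properties using (∨-assoc)
  open import Data.List as List using (List; []; _∷_; map; filterᵇ; length)
  open import Data.List.Properties using (map-++; map-∘)
  open import Data.Nat
  open import Data.Nat.ListAction using (sum)
  open import Data.Nat.ListAction.Properties using (sum-++)
  open import Data.Nat.Properties
  open import Data.Product using (_×_; _,_; ∃-syntax)
  open import Data.Vec using (Vec; []; _∷_; _∷ʳ_; _++_)
  open import Function using (_∘_)
  open import Relation.Binary.PropositionalEquality
  open import Defs using (subsets)

  +-interchange : ∀ a b c d → (a + b) + (c + d) ≡ (a + c) + (b + d)
  +-interchange = interchange +-commutativeSemigroup

  𝟙 : Bool → ℕ
  𝟙 true  = 1
  𝟙 false = 0

  𝟙≤1 : ∀ b → 𝟙 b ≤ 1
  𝟙≤1 true  = s≤s z≤n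
  𝟙≤1 false = z≤n

  ∑< : ℕ → (ℕ → ℕ) → ℕ
  ∑< zero    f = 0
  ∑< (suc n) f = f 0 + ∑< n (f ∘ suc)

  syntax ∑< n (λ i → e) = ∑[ i < n ] e

  any< : ℕ → (ℕ → Bool) → Bool
  any< zero    p = false
  any< (suc n) p = p 0 ∨ any< n (p ∘ suc)

  all< : ℕ → (ℕ → Bool) → Bool
  all< zero    p = true
  all< (suc n) p = p 0 ∧ all< n (p ∘ suc)

  count< : ℕ → (ℕ → Bool) → ℕ
  count< n p = ∑[ i < n ] 𝟙 (p i)

  ∑<-cong : ∀ n {f g} → (∀ i → i < n → f i ≡ g i) → ∑< n f ≡ ∑< n g
  ∑<-cong zero    eq = refl
  ∑<-cong (suc n) eq = cong₂ _+_ (eq 0 z<s) (∑<-cong n (λ i i<n → eq (suc i) (s<s i<n)))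

  ∑<-mono-≤ : ∀ n {f g} → (∀ i → i < n → f i ≤ g i) → ∑< n f ≤ ∑< n g
  ∑<-mono-≤ zero    le = z≤n
  ∑<-mono-≤ (suc n) le = +-mono-≤ (le 0 z<s) (∑<-mono-≤ n (λ i i<n → le (suc i) (s<s i<n)))

  ∑<-split : ∀ m n f → ∑< (m + n) f ≡ ∑< m f + ∑[ i < n ] f (m + i)
  ∑<-split zero    n f = refl
  ∑<-split (suc m) n f = trans (cong (f 0 +_) (∑<-split m n (f ∘ suc))) (sym (+-assoc (f 0) _ _))

  ∑<-suc : ∀ n f → ∑< (suc n) f ≡ ∑< n f + f n
  ∑<-suc zero    f = +-identityʳ (f 0)
  ∑<-suc (suc n) f = trans (cong (f 0 +_) (∑<-suc n (f ∘ suc))) (sym (+-assoc (f 0) _ _))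

  ∑<-distrib-+ : ∀ n f g → ∑[ i < n ] (f i + g i) ≡ ∑< n f + ∑< n g
  ∑<-distrib-+ zero    f g = refl
  ∑<-distrib-+ (suc n) f g =
    trans (cong (f 0 + g 0 +_) (∑<-distrib-+ n (f ∘ suc) (g ∘ suc)))
          (+-interchange (f 0) (g 0) _ _)

  ∑<-distribʳ-* : ∀ n f c → ∑[ i < n ] (f i * c) ≡ ∑< n f * c
  ∑<-distribʳ-* zero    f c = refl
  ∑<-distribʳ-* (suc n) f c =
    trans (cong (f 0 * c +_) (∑<-distribʳ-* n (f ∘ suc) c)) (sym (*-distribʳ-+ c (f 0) _))

  ∑<-reverse : ∀ n f → ∑< n f ≡ ∑[ i < n ] f (n ∸ suc i)
  ∑<-reverse zero    f = refl
  ∑<-reverse (suc n) f = begin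
    f 0 + ∑< n (f ∘ suc)                                  ≡⟨ cong (f 0 +_) (∑<-reverse n (f ∘ suc)) ⟩
    f 0 + ∑[ i < n ] f (suc (n ∸ suc i))                  ≡⟨ +-comm (f 0) _ ⟩
    ∑[ i < n ] f (suc (n ∸ suc i)) + f 0                  ≡⟨ cong₂ _+_ (∑<-cong n (λ i i<n → cong f (sym (+-∸-assoc 1 i<n))))
                                                                       (cong f (sym (n∸n≡0 n))) ⟩
    ∑[ i < n ] f (suc n ∸ suc i) + f (suc n ∸ suc n)      ≡⟨ ∑<-suc n (λ i → f (suc n ∸ suc i)) ⟨
    ∑[ i < suc n ] f (suc n ∸ suc i)                      ∎
    where open ≡-Reasoning

  count<-≤ : ∀ n p → count< n p ≤ n
  count<-≤ zero    p = z≤n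
  count<-≤ (suc n) p = +-mono-≤ (𝟙≤1 (p 0)) (count<-≤ n (p ∘ suc))

  all<⇒count<≡ : ∀ n p → all< n p ≡ true → count< n p ≡ n
  all<⇒count<≡ zero    p _ = refl
  all<⇒count<≡ (suc n) p h with p 0
  ... | true = cong suc (all<⇒count<≡ n (p ∘ suc) h)

  𝟙[¬all<]≤count<¬ : ∀ n p → 𝟙 (not (all< n p)) ≤ count< n (not ∘ p)
  𝟙[¬all<]≤count<¬ zero    p = z≤n
  𝟙[¬all<]≤count<¬ (suc n) p with p 0
  ... | true  = 𝟙[¬all<]≤count<¬ n (p ∘ suc)
  ... | false = s≤s z≤n

  any<-cong : ∀ n {p q} → (∀ i → i < n → p i ≡ q i) → any< n p ≡ any< n q
  any<-cong zero    eq = refl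
  any<-cong (suc n) eq = cong₂ _∨_ (eq 0 z<s) (any<-cong n (λ i i<n → eq (suc i) (s<s i<n)))

  any<-false : ∀ n {p} → (∀ i → i < n → p i ≡ false) → any< n p ≡ false
  any<-false n eq = trans (any<-cong n eq) (lemma n)
    where
    lemma : ∀ n → any< n (λ _ → false) ≡ false
    lemma zero    = refl
    lemma (suc n) = lemma n

  any<-intro : ∀ n {p} i → i < n → p i ≡ true → any< n p ≡ true
  any<-intro (suc n) {p} zero    _         pi with p 0
  ... | true = refl
  any<-intro (suc n) {p} (suc i) (s≤s i<n) pi with p 0
  ... | true  = refl
  ... | false = any<-intro n i i<n pi

  any<-elim : ∀ n {p} → any< n p ≡ true → ∃[ i ] (i < n × p i ≡ true)
  any<-elim (suc n) {p} h with p 0 in p0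
  ... | true  = 0 , z<s , p0
  ... | false with any<-elim n h
  ...   | i , i<n , pi = suc i , s<s i<n , pi

  any<-split : ∀ m n p → any< (m + n) p ≡ any< m p ∨ any< n (λ i → p (m + i))
  any<-split zero    n p = refl
  any<-split (suc m) n p = trans (cong (p 0 ∨_) (any<-split m n (p ∘ suc))) (sym (∨-assoc (p 0) _ _))

  ∑ₛ : (n : ℕ) → (Vec Bool n → ℕ) → ℕ
  ∑ₛ zero    f = f []
  ∑ₛ (suc n) f = ∑ₛ n (f ∘ (false ∷_)) + ∑ₛ n (f ∘ (true ∷_))

  ∑ₛ-cong : ∀ n {f g} → (∀ S → f S ≡ g S) → ∑ₛ n f ≡ ∑ₛ n g
  ∑ₛ-cong zero    eq = eq []
  ∑ₛ-cong (suc n) eq = cong₂ _+_ (∑ₛ-cong n (eq ∘ (false ∷_))) (∑ₛ-cong n (eq ∘ (true ∷_)))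

  ∑ₛ-mono-≤ : ∀ n {f g} → (∀ S → f S ≤ g S) → ∑ₛ n f ≤ ∑ₛ n g
  ∑ₛ-mono-≤ zero    le = le []
  ∑ₛ-mono-≤ (suc n) le = +-mono-≤ (∑ₛ-mono-≤ n (le ∘ (false ∷_))) (∑ₛ-mono-≤ n (le ∘ (true ∷_)))

  ∑ₛ-distrib-+ : ∀ n f g → ∑ₛ n (λ S → f S + g S) ≡ ∑ₛ n f + ∑ₛ n g
  ∑ₛ-distrib-+ zero    f g = refl
  ∑ₛ-distrib-+ (suc n) f g =
    trans (cong₂ _+_ (∑ₛ-distrib-+ n (f ∘ (false ∷_)) (g ∘ (false ∷_)))
                     (∑ₛ-distrib-+ n (f ∘ (true ∷_)) (g ∘ (true ∷_))))
          (+-interchange (∑ₛ n (f ∘ (false ∷_))) (∑ₛ n (g ∘ (false ∷_))) _ _)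

  ∑ₛ-distribˡ-* : ∀ n c f → ∑ₛ n (λ S → c * f S) ≡ c * ∑ₛ n f
  ∑ₛ-distribˡ-* zero    c f = refl
  ∑ₛ-distribˡ-* (suc n) c f =
    trans (cong₂ _+_ (∑ₛ-distribˡ-* n c (f ∘ (false ∷_))) (∑ₛ-distribˡ-* n c (f ∘ (true ∷_))))
          (sym (*-distribˡ-+ c _ _))

  ∑ₛ-distribʳ-* : ∀ n c f → ∑ₛ n (λ S → f S * c) ≡ ∑ₛ n f * c
  ∑ₛ-distribʳ-* n c f =
    trans (∑ₛ-cong n (λ S → *-comm (f S) c)) (trans (∑ₛ-distribˡ-* n c f) (*-comm c _))

  ∑ₛ-const : ∀ n c → ∑ₛ n (λ _ → c) ≡ 2 ^ n * c
  ∑ₛ-const zero    c = sym (+-identityʳ c)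
  ∑ₛ-const (suc n) c = begin
    ∑ₛ n (λ _ → c) + ∑ₛ n (λ _ → c)   ≡⟨ cong₂ _+_ (∑ₛ-const n c) (∑ₛ-const n c) ⟩
    2 ^ n * c + 2 ^ n * c             ≡⟨ *-distribʳ-+ c (2 ^ n) (2 ^ n) ⟨
    (2 ^ n + 2 ^ n) * c               ≡⟨ cong (λ x → (2 ^ n + x) * c) (+-identityʳ (2 ^ n)) ⟨
    2 ^ suc n * c                     ∎
    where open ≡-Reasoning

  ∑ₛ-zero : ∀ n → ∑ₛ n (λ _ → 0) ≡ 0
  ∑ₛ-zero n = trans (∑ₛ-const n 0) (*-zeroʳ (2 ^ n))

  ∑ₛ-++ : ∀ m n (f : Vec Bool (m + n) → ℕ) → ∑ₛ (m + n) f ≡ ∑ₛ m (λ U → ∑ₛ n (λ V → f (U ++ V)))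
  ∑ₛ-++ zero    n f = refl
  ∑ₛ-++ (suc m) n f = cong₂ _+_ (∑ₛ-++ m n _) (∑ₛ-++ m n _)

  ∑ₛ-∷ʳ : ∀ n (f : Vec Bool (suc n) → ℕ) → ∑ₛ (suc n) f ≡ ∑ₛ n (λ S → f (S ∷ʳ false)) + ∑ₛ n (λ S → f (S ∷ʳ true))
  ∑ₛ-∷ʳ zero    f = refl
  ∑ₛ-∷ʳ (suc n) f =
    trans (cong₂ _+_ (∑ₛ-∷ʳ n (f ∘ (false ∷_))) (∑ₛ-∷ʳ n (f ∘ (true ∷_))))
          (+-interchange (∑ₛ n (λ S → f (false ∷ (S ∷ʳ false)))) (∑ₛ n (λ S → f (false ∷ (S ∷ʳ true)))) _ _)

  ∑ₛ-∑<-comm : ∀ n k (f : Vec Bool n → ℕ → ℕ) → ∑ₛ n (λ S → ∑< k (f S)) ≡ ∑[ i < k ] ∑ₛ n (λ S → f S i)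
  ∑ₛ-∑<-comm n zero    f = ∑ₛ-zero n
  ∑ₛ-∑<-comm n (suc k) f =
    trans (∑ₛ-distrib-+ n (λ S → f S 0) (λ S → ∑< k (f S ∘ suc)))
          (cong (∑ₛ n (λ S → f S 0) +_) (∑ₛ-∑<-comm n k (λ S → f S ∘ suc)))

  length-filterᵇ : ∀ {A : Set} (p : A → Bool) xs → length (filterᵇ p xs) ≡ sum (map (𝟙 ∘ p) xs)
  length-filterᵇ p []       = refl
  length-filterᵇ p (x ∷ xs) with p x
  ... | true  = cong suc (length-filterᵇ p xs)
  ... | false = length-filterᵇ p xs

  sum-map-subsets : ∀ n (f : Vec Bool n → ℕ) → sum (map f (subsets n)) ≡ ∑ₛ n f
  sum-map-subsets zero    f = +-identityʳ (f [])
  sum-map-subsets (suc n) f = begin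
    sum (map f (map (false ∷_) (subsets n) List.++ map (true ∷_) (subsets n)))
      ≡⟨ cong sum (map-++ f (map (false ∷_) (subsets n)) _) ⟩
    sum (map f (map (false ∷_) (subsets n)) List.++ map f (map (true ∷_) (subsets n)))
      ≡⟨ sum-++ (map f (map (false ∷_) (subsets n))) _ ⟩
    sum (map f (map (false ∷_) (subsets n))) + sum (map f (map (true ∷_) (subsets n)))
      ≡⟨ cong₂ (λ xs ys → sum xs + sum ys) (map-∘ (subsets n)) (map-∘ (subsets n)) ⟨
    sum (map (f ∘ (false ∷_)) (subsets n)) + sum (map (f ∘ (true ∷_)) (subsets n))
      ≡⟨ cong₂ _+_ (sum-map-subsets n _) (sum-map-subsets n _) ⟩
    ∑ₛ (suc n) f ∎
    where open ≡-Reasoning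

  length-filterᵇ-subsets : ∀ n (p : Vec Bool n → Bool) → length (filterᵇ p (subsets n)) ≡ ∑ₛ n (𝟙 ∘ p)
  length-filterᵇ-subsets n p = trans (length-filterᵇ p (subsets n)) (sum-map-subsets n (𝟙 ∘ p))

module Differences where

  open import Data.Bool using (Bool; true; false; _∧_; _∨_)
  open import Data.Bool.Properties using (⇔→≡; ∧-zeroʳ; ∨-identityʳ; ∨-assoc)
  open import Data.List.Properties using (map-∘)
  open import Data.Fin as Fin using (Fin; toℕ)
  open import Data.Integer as ℤ using (ℤ; +_; -[1+_])
  import Data.Integer.Properties as ℤ
  open import Data.Integer.Tactic.RingSolver using (solve-∀)
  open import Data.List as List using (List; []; _∷_; map; filterᵇ; length; applyUpTo; tabulate; concatMap)
  open import Data.Bool.ListAction using (or)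
  open import Data.Nat
  open import Data.Nat.ListAction using (sum)
  open import Data.Nat.Properties
  open import Data.Product using (_×_; _,_; ∃-syntax)
  open import Data.Vec using (Vec; []; _∷_; _∷ʳ_; _++_; lookup)
  open import Function using (_∘_; id; mk⇔)
  open import Relation.Binary.PropositionalEquality
  open import Relation.Nullary using (does; yes; no)
  open import Relation.Nullary.Decidable using (dec-true)
  open import Defs
  open Sums

  ∧≡true⇒ : ∀ {a b} → a ∧ b ≡ true → a ≡ true × b ≡ true
  ∧≡true⇒ {true} {true} _ = refl , refl

  ∧≡true⇐ : ∀ {a b} → a ≡ true → b ≡ true → a ∧ b ≡ true
  ∧≡true⇐ refl refl = refl

  does-≟⇒≡ : ∀ {x y : ℤ} → does (x ℤ.≟ y) ≡ true → x ≡ y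
  does-≟⇒≡ {x} {y} h with x ℤ.≟ y
  ... | yes x≡y = x≡y

  _∈ᵇ_ : ∀ {n} → ℕ → Vec Bool n → Bool
  i     ∈ᵇ []      = false
  zero  ∈ᵇ (b ∷ S) = b
  suc i ∈ᵇ (b ∷ S) = i ∈ᵇ S

  ∈ᵇ-outside : ∀ {n} (S : Vec Bool n) {i} → n ≤ i → i ∈ᵇ S ≡ false
  ∈ᵇ-outside []      _         = refl
  ∈ᵇ-outside (b ∷ S) (s≤s n≤i) = ∈ᵇ-outside S n≤i

  ∈ᵇ⇒< : ∀ {n} (S : Vec Bool n) i → i ∈ᵇ S ≡ true → i < n
  ∈ᵇ⇒< {n} S i h with i <? n
  ... | yes i<n = i<n
  ... | no  i≮n with () ← trans (sym h) (∈ᵇ-outside S (≮⇒≥ i≮n))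

  lookup≡toℕ∈ᵇ : ∀ {n} (S : Vec Bool n) x → lookup S x ≡ toℕ x ∈ᵇ S
  lookup≡toℕ∈ᵇ (b ∷ S) Fin.zero    = refl
  lookup≡toℕ∈ᵇ (b ∷ S) (Fin.suc x) = lookup≡toℕ∈ᵇ S x

  ∈ᵇ-++ˡ : ∀ {m n} (U : Vec Bool m) (V : Vec Bool n) {i} → i < m → i ∈ᵇ (U ++ V) ≡ i ∈ᵇ U
  ∈ᵇ-++ˡ (b ∷ U) V {zero}  _         = refl
  ∈ᵇ-++ˡ (b ∷ U) V {suc i} (s≤s i<m) = ∈ᵇ-++ˡ U V i<m

  ∈ᵇ-++ʳ : ∀ {m n} (U : Vec Bool m) (V : Vec Bool n) j → (m + j) ∈ᵇ (U ++ V) ≡ j ∈ᵇ V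
  ∈ᵇ-++ʳ []      V j = refl
  ∈ᵇ-++ʳ (b ∷ U) V j = ∈ᵇ-++ʳ U V j

  ∈ᵇ-++-∷ʳˡ : ∀ {m n} (U : Vec Bool m) (V : Vec Bool n) b {i} → i < m → i ∈ᵇ ((U ++ V) ∷ʳ b) ≡ i ∈ᵇ U
  ∈ᵇ-++-∷ʳˡ (c ∷ U) V b {zero}  _         = refl
  ∈ᵇ-++-∷ʳˡ (c ∷ U) V b {suc i} (s≤s i<m) = ∈ᵇ-++-∷ʳˡ U V b i<m

  ∈ᵇ-++-∷ʳʳ : ∀ {m n} (U : Vec Bool m) (V : Vec Bool n) b j → (m + j) ∈ᵇ ((U ++ V) ∷ʳ b) ≡ j ∈ᵇ (V ∷ʳ b)
  ∈ᵇ-++-∷ʳʳ []      V b j = refl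
  ∈ᵇ-++-∷ʳʳ (c ∷ U) V b j = ∈ᵇ-++-∷ʳʳ U V b j

  ∈ᵇ-∷ʳ-false : ∀ {n} (S : Vec Bool n) i → i ∈ᵇ (S ∷ʳ false) ≡ i ∈ᵇ S
  ∈ᵇ-∷ʳ-false []      zero    = refl
  ∈ᵇ-∷ʳ-false []      (suc i) = refl
  ∈ᵇ-∷ʳ-false (b ∷ S) zero    = refl
  ∈ᵇ-∷ʳ-false (b ∷ S) (suc i) = ∈ᵇ-∷ʳ-false S i

  hasDiff : ∀ {n} → Vec Bool n → ℕ → Bool
  hasDiff {n} S d = any< n (λ x → x ∈ᵇ S ∧ (x + d) ∈ᵇ S)

  hasDiff-outside : ∀ {n} (S : Vec Bool n) {d} → n ≤ d → hasDiff S d ≡ false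
  hasDiff-outside {n} S {d} n≤d =
    any<-false n (λ x _ → trans (cong (x ∈ᵇ S ∧_) (∈ᵇ-outside S (≤-trans n≤d (m≤n+m d x)))) (∧-zeroʳ _))

  hasDiff-∷ʳ-false : ∀ {n} (S : Vec Bool n) d → hasDiff (S ∷ʳ false) d ≡ hasDiff S d
  hasDiff-∷ʳ-false {n} S d = begin
    any< (suc n) (λ x → x ∈ᵇ (S ∷ʳ false) ∧ (x + d) ∈ᵇ (S ∷ʳ false))
      ≡⟨ any<-cong (suc n) (λ x _ → cong₂ _∧_ (∈ᵇ-∷ʳ-false S x) (∈ᵇ-∷ʳ-false S (x + d))) ⟩
    any< (suc n) p
      ≡⟨ cong (λ k → any< k p) (+-comm 1 n) ⟩
    any< (n + 1) p
      ≡⟨ any<-split n 1 p ⟩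
    hasDiff S d ∨ ((n + 0) ∈ᵇ S ∧ (n + 0 + d) ∈ᵇ S ∨ false)
      ≡⟨ cong (λ b → hasDiff S d ∨ (b ∧ (n + 0 + d) ∈ᵇ S ∨ false)) (∈ᵇ-outside S (m≤m+n n 0)) ⟩
    hasDiff S d ∨ false
      ≡⟨ ∨-identityʳ _ ⟩
    hasDiff S d ∎
    where
    open ≡-Reasoning
    p : ℕ → Bool
    p x = x ∈ᵇ S ∧ (x + d) ∈ᵇ S

  #posDiffs : ∀ {n} → Vec Bool n → ℕ
  #posDiffs {n} S = count< n (λ j → hasDiff S (suc j))

  #posDiffs-drop-last : ∀ {m} (S : Vec Bool m) n → m ≤ suc n →
    count< (suc n) (λ j → hasDiff S (suc j)) ≡ count< n (λ j → hasDiff S (suc j))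
  #posDiffs-drop-last S n m≤1+n = begin
    count< (suc n) (λ j → hasDiff S (suc j))
      ≡⟨ ∑<-suc n _ ⟩
    count< n (λ j → hasDiff S (suc j)) + 𝟙 (hasDiff S (suc n))
      ≡⟨ cong (λ b → count< n (λ j → hasDiff S (suc j)) + 𝟙 b) (hasDiff-outside S m≤1+n) ⟩
    count< n (λ j → hasDiff S (suc j)) + 0
      ≡⟨ +-identityʳ _ ⟩
    count< n (λ j → hasDiff S (suc j)) ∎
    where open ≡-Reasoning

  #posDiffs-false∷ : ∀ {n} (S : Vec Bool n) → #posDiffs (false ∷ S) ≡ #posDiffs S
  #posDiffs-false∷ {n} S = #posDiffs-drop-last S n (n≤1+n n)

  #posDiffs-∷ʳ-false : ∀ {n} (S : Vec Bool n) → #posDiffs (S ∷ʳ false) ≡ #posDiffs S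
  #posDiffs-∷ʳ-false {n} S =
    trans (∑<-cong (suc n) (λ j _ → cong 𝟙 (hasDiff-∷ʳ-false S (suc j)))) (#posDiffs-drop-last S n (n≤1+n n))

  #posDiffs≤ : ∀ {n} (S : Vec Bool (suc n)) → #posDiffs S ≤ n
  #posDiffs≤ {n} S = ≤-trans (≤-reflexive (#posDiffs-drop-last S n ≤-refl)) (count<-≤ n _)

  or-++ : ∀ xs ys → or (xs List.++ ys) ≡ or xs ∨ or ys
  or-++ []       ys = refl
  or-++ (x ∷ xs) ys = trans (cong (x ∨_) (or-++ xs ys)) (sym (∨-assoc x _ _))

  or-map-tabulate : ∀ n {A : Set} (f : Fin n → A) (p : A → Bool) (q : ℕ → Bool) →
    (∀ i → p (f i) ≡ q (toℕ i)) → or (map p (tabulate f)) ≡ any< n q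
  or-map-tabulate zero    f p q eq = refl
  or-map-tabulate (suc n) f p q eq =
    cong₂ _∨_ (eq Fin.zero) (or-map-tabulate n (f ∘ Fin.suc) p (q ∘ suc) (eq ∘ Fin.suc))

  or-concatMap-tabulate : ∀ n {A : Set} (f : Fin n → A) (ps : A → List Bool) (q : ℕ → Bool) →
    (∀ i → or (ps (f i)) ≡ q (toℕ i)) → or (concatMap ps (tabulate f)) ≡ any< n q
  or-concatMap-tabulate zero    f ps q eq = refl
  or-concatMap-tabulate (suc n) f ps q eq =
    trans (or-++ (ps (f Fin.zero)) _)
          (cong₂ _∨_ (eq Fin.zero) (or-concatMap-tabulate n (f ∘ Fin.suc) ps (q ∘ suc) (eq ∘ Fin.suc)))

  hasIntDiff : ∀ {n} → Vec Bool n → ℤ → Bool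
  hasIntDiff {n} S d = any< n (λ x → any< n (λ y → x ∈ᵇ S ∧ y ∈ᵇ S ∧ does (+ x ℤ.- + y ℤ.≟ d)))

  inDiff≡hasIntDiff : ∀ {n} (S : Vec Bool n) d → inDiff S d ≡ hasIntDiff S d
  inDiff≡hasIntDiff {n} S d = or-concatMap-tabulate n id _ _ (λ x → or-map-tabulate n id _ _ (λ y →
    cong₂ (λ a b → a ∧ b ∧ does (+ toℕ x ℤ.- + toℕ y ℤ.≟ d)) (lookup≡toℕ∈ᵇ S x) (lookup≡toℕ∈ᵇ S y)))

  private
    +x-+y≡+e⇒x≡y+e : ∀ {x y e} → + x ℤ.- + y ≡ + e → x ≡ y + e
    +x-+y≡+e⇒x≡y+e {x} {y} {e} h = ℤ.+-injective (begin
      + x                     ≡⟨ lemma (+ x) (+ y) ⟩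
      (+ x ℤ.- + y) ℤ.+ + y   ≡⟨ cong (ℤ._+ + y) h ⟩
      + e ℤ.+ + y             ≡⟨ ℤ.pos-+ e y ⟨
      + (e + y)               ≡⟨ cong +_ (+-comm e y) ⟩
      + (y + e)               ∎)
      where
      open ≡-Reasoning
      lemma : ∀ a b → a ≡ (a ℤ.- b) ℤ.+ b
      lemma = solve-∀

    +[y+e]-+y≡+e : ∀ y e → + (y + e) ℤ.- + y ≡ + e
    +[y+e]-+y≡+e y e = trans (cong (ℤ._- + y) (ℤ.pos-+ y e)) (lemma (+ y) (+ e))
      where
      lemma : ∀ a b → (a ℤ.+ b) ℤ.- a ≡ b
      lemma = solve-∀

    +x-+y≡-[1+e]⇒y≡x+1+e : ∀ {x y e} → + x ℤ.- + y ≡ -[1+ e ] → y ≡ x + suc e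
    +x-+y≡-[1+e]⇒y≡x+1+e {x} {y} {e} h = ℤ.+-injective (begin
      + y                     ≡⟨ lemma (+ x) (+ y) ⟩
      + x ℤ.- (+ x ℤ.- + y)   ≡⟨ cong (λ z → + x ℤ.- z) h ⟩
      + x ℤ.+ + suc e         ≡⟨ ℤ.pos-+ x (suc e) ⟨
      + (x + suc e)           ∎)
      where
      open ≡-Reasoning
      lemma : ∀ a b → b ≡ a ℤ.- (a ℤ.- b)
      lemma = solve-∀

    +x-+[x+1+e]≡-[1+e] : ∀ x e → + x ℤ.- + (x + suc e) ≡ -[1+ e ]
    +x-+[x+1+e]≡-[1+e] x e = trans (cong (λ z → + x ℤ.- z) (ℤ.pos-+ x (suc e))) (lemma (+ x) (+ suc e))
      where
      lemma : ∀ a b → a ℤ.- (a ℤ.+ b) ≡ ℤ.- b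
      lemma = solve-∀

  hasIntDiff-+ : ∀ {n} (S : Vec Bool n) e → hasIntDiff S (+ e) ≡ hasDiff S e
  hasIntDiff-+ {n} S e = ⇔→≡ (mk⇔ to from)
    where
    to : hasIntDiff S (+ e) ≡ true → hasDiff S e ≡ true
    to h with any<-elim n h
    ... | x , _ , h′ with any<-elim n h′
    ... | y , y<n , h″ with ∧≡true⇒ h″
    ... | x∈S , h‴ with ∧≡true⇒ h‴
    ... | y∈S , x-y≡e =
      any<-intro n y y<n (∧≡true⇐ y∈S (subst (λ z → z ∈ᵇ S ≡ true) (+x-+y≡+e⇒x≡y+e {x} {y} (does-≟⇒≡ x-y≡e)) x∈S))
    from : hasDiff S e ≡ true → hasIntDiff S (+ e) ≡ true
    from h with any<-elim n h
    ... | y , y<n , h′ with ∧≡true⇒ h′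
    ... | y∈S , y+e∈S =
      any<-intro n (y + e) (∈ᵇ⇒< S (y + e) y+e∈S) (any<-intro n y y<n
        (∧≡true⇐ y+e∈S (∧≡true⇐ y∈S (dec-true (_ ℤ.≟ _) (+[y+e]-+y≡+e y e)))))

  hasIntDiff-[1+] : ∀ {n} (S : Vec Bool n) e → hasIntDiff S -[1+ e ] ≡ hasDiff S (suc e)
  hasIntDiff-[1+] {n} S e = ⇔→≡ (mk⇔ to from)
    where
    to : hasIntDiff S -[1+ e ] ≡ true → hasDiff S (suc e) ≡ true
    to h with any<-elim n h
    ... | x , x<n , h′ with any<-elim n h′
    ... | y , _ , h″ with ∧≡true⇒ h″
    ... | x∈S , h‴ with ∧≡true⇒ h‴
    ... | y∈S , x-y≡-[1+e] =
      any<-intro n x x<n (∧≡true⇐ x∈S (subst (λ z → z ∈ᵇ S ≡ true) (+x-+y≡-[1+e]⇒y≡x+1+e {x} {y} (does-≟⇒≡ x-y≡-[1+e])) y∈S))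
    from : hasDiff S (suc e) ≡ true → hasIntDiff S -[1+ e ] ≡ true
    from h with any<-elim n h
    ... | x , x<n , h′ with ∧≡true⇒ h′
    ... | x∈S , x+1+e∈S =
      any<-intro n x x<n (any<-intro n (x + suc e) (∈ᵇ⇒< S (x + suc e) x+1+e∈S)
        (∧≡true⇐ x∈S (∧≡true⇐ x+1+e∈S (dec-true (_ ℤ.≟ _) (+x-+[x+1+e]≡-[1+e] x e)))))

  inDiff-+ : ∀ {n} (S : Vec Bool n) e → inDiff S (+ e) ≡ hasDiff S e
  inDiff-+ S e = trans (inDiff≡hasIntDiff S (+ e)) (hasIntDiff-+ S e)

  inDiff-[1+] : ∀ {n} (S : Vec Bool n) e → inDiff S -[1+ e ] ≡ hasDiff S (suc e)
  inDiff-[1+] S e = trans (inDiff≡hasIntDiff S -[1+ e ]) (hasIntDiff-[1+] S e)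

  sum-map-applyUpTo : ∀ (f : ℕ → ℕ) g k → sum (map f (applyUpTo g k)) ≡ ∑[ i < k ] f (g i)
  sum-map-applyUpTo f g zero    = refl
  sum-map-applyUpTo f g (suc k) = cong (_+_ (f (g 0))) (sum-map-applyUpTo f (g ∘ suc) k)

  -- S - S is symmetric, and 0 ∈ S - S iff S is nonempty
  diffCard≡ : ∀ {n} (S : Vec Bool n) → diffCard S ≡ #posDiffs S + (𝟙 (hasDiff S 0) + #posDiffs S)
  diffCard≡ {n} S = begin
    diffCard S
      ≡⟨ length-filterᵇ (inDiff S) (intRange n) ⟩
    sum (map (𝟙 ∘ inDiff S) (map (λ i → + i ℤ.- + n) (List.upTo (2 * n + 1))))
      ≡⟨ cong sum (map-∘ (List.upTo (2 * n + 1))) ⟨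
    sum (map d (List.upTo (2 * n + 1)))
      ≡⟨ sum-map-applyUpTo d id (2 * n + 1) ⟩
    ∑< (2 * n + 1) d
      ≡⟨ cong (λ k → ∑< k d) 2n+1≡n+[1+n] ⟩
    ∑< (n + suc n) d
      ≡⟨ ∑<-split n (suc n) d ⟩
    ∑< n d + (d (n + 0) + ∑[ i < n ] d (n + suc i))
      ≡⟨ cong₂ _+_ negative (cong₂ _+_ (positive 0) (∑<-cong n (λ i _ → positive (suc i)))) ⟩
    #posDiffs S + (𝟙 (hasDiff S 0) + #posDiffs S) ∎
    where
    open ≡-Reasoning
    d : ℕ → ℕ
    d i = 𝟙 (inDiff S (+ i ℤ.- + n))
    2n+1≡n+[1+n] : 2 * n + 1 ≡ n + suc n
    2n+1≡n+[1+n] = trans (+-comm (2 * n) 1) (trans (cong (λ m → suc (n + m)) (+-identityʳ n)) (sym (+-suc n n)))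
    positive : ∀ e → d (n + e) ≡ 𝟙 (hasDiff S e)
    positive e = cong 𝟙 (trans (cong (inDiff S) (+[y+e]-+y≡+e n e)) (inDiff-+ S e))
    +i-+n≡-[1+n∸1+i] : ∀ {i} → i < n → + i ℤ.- + n ≡ -[1+ n ∸ suc i ]
    +i-+n≡-[1+n∸1+i] {i} i<n = begin
      + i ℤ.- + n                          ≡⟨ cong (λ m → + i ℤ.- + m) (m+[n∸m]≡n (<⇒≤ i<n)) ⟨
      + i ℤ.- + (i + (n ∸ i))              ≡⟨ cong (λ m → + i ℤ.- + (i + m)) (+-∸-assoc 1 i<n) ⟩
      + i ℤ.- + (i + suc (n ∸ suc i))      ≡⟨ +x-+[x+1+e]≡-[1+e] i (n ∸ suc i) ⟩
      -[1+ n ∸ suc i ]                     ∎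
    negative : ∑< n d ≡ #posDiffs S
    negative = trans (∑<-cong n (λ i i<n → cong 𝟙 (trans (cong (inDiff S) (+i-+n≡-[1+n∸1+i] i<n)) (inDiff-[1+] S _))))
                     (sym (∑<-reverse n (λ j → 𝟙 (hasDiff S (suc j)))))

  stat-pad : ∀ {n} (S : Vec Bool n) (T : Vec Bool (suc n)) → diffCard T ≡ diffCard S → stat T ≡ stat S ℤ.+ + 2
  stat-pad {n} S T eq = begin
    (+ (2 * suc n) ℤ.- + 1) ℤ.- + diffCard T         ≡⟨ cong₂ (λ a b → (+ a ℤ.- + 1) ℤ.- + b) (*-suc 2 n) eq ⟩
    (+ (2 + 2 * n) ℤ.- + 1) ℤ.- + diffCard S         ≡⟨ cong (λ a → (a ℤ.- + 1) ℤ.- + diffCard S) (ℤ.pos-+ 2 (2 * n)) ⟩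
    ((+ 2 ℤ.+ + (2 * n)) ℤ.- + 1) ℤ.- + diffCard S   ≡⟨ lemma (+ (2 * n)) (+ diffCard S) ⟩
    stat S ℤ.+ + 2                                   ∎
    where
    open ≡-Reasoning
    lemma : ∀ a b → ((+ 2 ℤ.+ a) ℤ.- + 1) ℤ.- b ≡ ((a ℤ.- + 1) ℤ.- b) ℤ.+ + 2
    lemma = solve-∀

  diffCard-false∷ : ∀ {n} (S : Vec Bool n) → diffCard (false ∷ S) ≡ diffCard S
  diffCard-false∷ S = begin
    diffCard (false ∷ S)                                                ≡⟨ diffCard≡ (false ∷ S) ⟩
    #posDiffs (false ∷ S) + (𝟙 (hasDiff S 0) + #posDiffs (false ∷ S))   ≡⟨ cong (λ p → p + (𝟙 (hasDiff S 0) + p)) (#posDiffs-false∷ S) ⟩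
    #posDiffs S + (𝟙 (hasDiff S 0) + #posDiffs S)                       ≡⟨ diffCard≡ S ⟨
    diffCard S                                                          ∎
    where open ≡-Reasoning

  diffCard-∷ʳ-false : ∀ {n} (S : Vec Bool n) → diffCard (S ∷ʳ false) ≡ diffCard S
  diffCard-∷ʳ-false S = begin
    diffCard (S ∷ʳ false)
      ≡⟨ diffCard≡ (S ∷ʳ false) ⟩
    #posDiffs (S ∷ʳ false) + (𝟙 (hasDiff (S ∷ʳ false) 0) + #posDiffs (S ∷ʳ false))
      ≡⟨ cong₂ (λ p z → p + (𝟙 z + p)) (#posDiffs-∷ʳ-false S) (hasDiff-∷ʳ-false S 0) ⟩
    #posDiffs S + (𝟙 (hasDiff S 0) + #posDiffs S)
      ≡⟨ diffCard≡ S ⟨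
    diffCard S ∎
    where open ≡-Reasoning

  stat-false∷ : ∀ {n} (S : Vec Bool n) → stat (false ∷ S) ≡ stat S ℤ.+ + 2
  stat-false∷ S = stat-pad S (false ∷ S) (diffCard-false∷ S)

  stat-∷ʳ-false : ∀ {n} (S : Vec Bool n) → stat (S ∷ʳ false) ≡ stat S ℤ.+ + 2
  stat-∷ʳ-false S = stat-pad S (S ∷ʳ false) (diffCard-∷ʳ-false S)

  stat-nonneg : ∀ {n} (S : Vec Bool (suc n)) → + 0 ℤ.≤ stat S
  stat-nonneg {n} S = ℤ.i≤j⇒0≤j-i (ℤ.+≤+ (begin
    diffCard S                                       ≡⟨ diffCard≡ S ⟩
    #posDiffs S + (𝟙 (hasDiff S 0) + #posDiffs S)    ≤⟨ +-mono-≤ (#posDiffs≤ S) (+-mono-≤ (𝟙≤1 (hasDiff S 0)) (#posDiffs≤ S)) ⟩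
    n + suc n                                        ≡⟨ cong (λ m → n + suc m) (+-identityʳ n) ⟨
    n + suc (n + 0)                                  ∎))
    where open ≤-Reasoning

module Recurrences where

  open import Data.Bool using (Bool; true; false; _∧_)
  open import Data.Fin as Fin using ()
  open import Data.Integer as ℤ using (ℤ; +_)
  import Data.Integer.Properties as ℤ
  open import Data.Integer.Tactic.RingSolver using (solve-∀)
  open import Data.List using (filterᵇ; length)
  open import Data.Nat
  open import Data.Nat.Properties
  open import Data.Vec using (Vec; []; _∷_; _∷ʳ_; lookup)
  open import Function using (_∘_; _⇔_; mk⇔)
  open import Relation.Binary.PropositionalEquality
  open import Relation.Nullary using (does)
  open import Relation.Nullary.Decidable using (does-⇔; dec-false)
  open import Defs
  open Sums
  open Differences

  hasStat : ∀ {n} → Vec Bool n → ℤ → Bool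
  hasStat S t = does (stat S ℤ.≟ t)

  -- Unnormalised counts: ℓ# n t = 2ⁿ ℓₙ(t) and j# m t = 2ᵐ jₘ₊₂(t); f# n t counts the subsets of [n+1] containing 0.
  ℓ# : ℕ → ℤ → ℕ
  ℓ# n t = ∑ₛ n (λ S → 𝟙 (hasStat S t))

  f# : ℕ → ℤ → ℕ
  f# n t = ∑ₛ n (λ S → 𝟙 (hasStat (true ∷ S) t))

  withEnds : ∀ {m} → Vec Bool m → Vec Bool (suc (suc m))
  withEnds S = true ∷ (S ∷ʳ true)

  j# : ℕ → ℤ → ℕ
  j# m t = ∑ₛ m (λ S → 𝟙 (hasStat (withEnds S) t))

  countStat≡ℓ# : ∀ n t → countStat n t ≡ ℓ# n t
  countStat≡ℓ# n t = length-filterᵇ-subsets n (λ S → hasStat S t)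

  lookup-∷ʳ-last : ∀ {m} (S : Vec Bool m) b → lookup (S ∷ʳ b) (Fin.fromℕ m) ≡ b
  lookup-∷ʳ-last []      b = refl
  lookup-∷ʳ-last (c ∷ S) b = lookup-∷ʳ-last S b

  #endpointsIn≡j# : ∀ m t →
    length (filterᵇ (λ S → endpointsIn S ∧ hasStat S t) (subsets (suc (suc m)))) ≡ j# m t
  #endpointsIn≡j# m t = begin
    length (filterᵇ p (subsets (suc (suc m))))
      ≡⟨ length-filterᵇ-subsets (suc (suc m)) p ⟩
    ∑ₛ (suc m) (λ _ → 0) + ∑ₛ (suc m) (λ S → 𝟙 (p (true ∷ S)))
      ≡⟨ cong₂ _+_ (∑ₛ-zero (suc m)) (∑ₛ-∷ʳ m (λ S → 𝟙 (p (true ∷ S)))) ⟩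
    ∑ₛ m (λ S → 𝟙 (p (true ∷ (S ∷ʳ false)))) + ∑ₛ m (λ S → 𝟙 (p (true ∷ (S ∷ʳ true))))
      ≡⟨ cong₂ _+_ (trans (∑ₛ-cong m (λ S → cong (λ b → 𝟙 (b ∧ hasStat (true ∷ (S ∷ʳ false)) t)) (lookup-∷ʳ-last S false)))
                          (∑ₛ-zero m))
                   (∑ₛ-cong m (λ S → cong (λ b → 𝟙 (b ∧ hasStat (true ∷ (S ∷ʳ true)) t)) (lookup-∷ʳ-last S true))) ⟩
    j# m t ∎
    where
    open ≡-Reasoning
    p : Vec Bool (suc (suc m)) → Bool
    p S = endpointsIn S ∧ hasStat S t

  x+2≡t⇔x≡t-2 : ∀ {x t} → x ℤ.+ + 2 ≡ t ⇔ x ≡ t ℤ.- + 2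
  x+2≡t⇔x≡t-2 {x} {t} = mk⇔ (λ eq → trans (lemma₁ x) (cong (ℤ._- + 2) eq)) (λ eq → trans (cong (ℤ._+ + 2) eq) (lemma₂ t))
    where
    lemma₁ : ∀ x → x ≡ (x ℤ.+ + 2) ℤ.- + 2
    lemma₁ = solve-∀
    lemma₂ : ∀ t → (t ℤ.- + 2) ℤ.+ + 2 ≡ t
    lemma₂ = solve-∀

  hasStat-+2 : ∀ {n} (S : Vec Bool n) (T : Vec Bool (suc n)) t →
    stat T ≡ stat S ℤ.+ + 2 → hasStat T t ≡ hasStat S (t ℤ.- + 2)
  hasStat-+2 S T t eq = does-⇔ (subst (λ x → x ≡ t ⇔ _) (sym eq) x+2≡t⇔x≡t-2) (stat T ℤ.≟ t) (stat S ℤ.≟ t ℤ.- + 2)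

  ℓ#-suc : ∀ n t → ℓ# (suc n) t ≡ ℓ# n (t ℤ.- + 2) + f# n t
  ℓ#-suc n t = cong (_+ f# n t) (∑ₛ-cong n (λ S → cong 𝟙 (hasStat-+2 S (false ∷ S) t (stat-false∷ S))))

  f#-suc : ∀ n t → f# (suc n) t ≡ f# n (t ℤ.- + 2) + j# n t
  f#-suc n t = trans (∑ₛ-∷ʳ n (λ S → 𝟙 (hasStat (true ∷ S) t)))
    (cong (_+ j# n t) (∑ₛ-cong n (λ S → cong 𝟙 (hasStat-+2 (true ∷ S) (true ∷ (S ∷ʳ false)) t (stat-∷ʳ-false (true ∷ S))))))

  j#≡Δ²ℓ# : ∀ m t →
    + j# m t ≡ (+ ℓ# (suc (suc m)) t ℤ.- + 2 ℤ.* + ℓ# (suc m) (t ℤ.- + 2)) ℤ.+ + ℓ# m ((t ℤ.- + 2) ℤ.- + 2)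
  j#≡Δ²ℓ# m t = trans (lemma (+ ℓ₀) (+ f₀) (+ j# m t)) (sym (cong₂ (λ a b → (a ℤ.- + 2 ℤ.* b) ℤ.+ + ℓ₀) ℓ₂≡ ℓ₁≡))
    where
    ℓ₀ = ℓ# m ((t ℤ.- + 2) ℤ.- + 2)
    f₀ = f# m (t ℤ.- + 2)
    ℓ₁≡ : + ℓ# (suc m) (t ℤ.- + 2) ≡ + ℓ₀ ℤ.+ + f₀
    ℓ₁≡ = trans (cong +_ (ℓ#-suc m (t ℤ.- + 2))) (ℤ.pos-+ ℓ₀ f₀)
    ℓ₂≡ : + ℓ# (suc (suc m)) t ≡ (+ ℓ₀ ℤ.+ + f₀) ℤ.+ (+ f₀ ℤ.+ + j# m t)
    ℓ₂≡ = trans (cong +_ (ℓ#-suc (suc m) t))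
           (trans (ℤ.pos-+ (ℓ# (suc m) (t ℤ.- + 2)) (f# (suc m) t))
             (cong₂ ℤ._+_ ℓ₁≡ (trans (cong +_ (f#-suc m t)) (ℤ.pos-+ f₀ (j# m t)))))
    lemma : ∀ ℓ f j → j ≡ (((ℓ ℤ.+ f) ℤ.+ (f ℤ.+ j)) ℤ.- + 2 ℤ.* (ℓ ℤ.+ f)) ℤ.+ ℓ
    lemma = solve-∀

  hasStat-neg : ∀ {n} (S : Vec Bool (suc n)) t → t ℤ.< + 0 → hasStat S t ≡ false
  hasStat-neg S t t<0 = dec-false (stat S ℤ.≟ t) (λ eq → ℤ.<⇒≢ (ℤ.<-≤-trans t<0 (stat-nonneg S)) (sym eq))

  ℓ#-neg : ∀ n t → t ℤ.< + 0 → ℓ# (suc n) t ≡ 0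
  ℓ#-neg n t t<0 = trans (∑ₛ-cong (suc n) (λ S → cong 𝟙 (hasStat-neg S t t<0))) (∑ₛ-zero (suc n))

  f#-neg : ∀ n t → t ℤ.< + 0 → f# n t ≡ 0
  f#-neg n t t<0 = trans (∑ₛ-cong n (λ S → cong 𝟙 (hasStat-neg (true ∷ S) t t<0))) (∑ₛ-zero n)

  t-2-2s≡t-2[1+s] : ∀ t s → (t ℤ.- + 2) ℤ.- + (2 * s) ≡ t ℤ.- + (2 * suc s)
  t-2-2s≡t-2[1+s] t s = begin
    (t ℤ.- + 2) ℤ.- + (2 * s)   ≡⟨ lemma t (+ (2 * s)) ⟩
    t ℤ.- (+ 2 ℤ.+ + (2 * s))   ≡⟨ cong (λ a → t ℤ.- a) (ℤ.pos-+ 2 (2 * s)) ⟨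
    t ℤ.- + (2 + 2 * s)         ≡⟨ cong (λ a → t ℤ.- + a) (*-suc 2 s) ⟨
    t ℤ.- + (2 * suc s)         ∎
    where
    open ≡-Reasoning
    lemma : ∀ t a → (t ℤ.- + 2) ℤ.- a ≡ t ℤ.- (+ 2 ℤ.+ a)
    lemma = solve-∀

  t-2s-2s′≡t-2[s+s′] : ∀ t s s′ → (t ℤ.- + (2 * s)) ℤ.- + (2 * s′) ≡ t ℤ.- + (2 * (s + s′))
  t-2s-2s′≡t-2[s+s′] t s s′ = begin
    (t ℤ.- + (2 * s)) ℤ.- + (2 * s′)     ≡⟨ lemma t (+ (2 * s)) (+ (2 * s′)) ⟩
    t ℤ.- (+ (2 * s) ℤ.+ + (2 * s′))     ≡⟨ cong (λ a → t ℤ.- a) (ℤ.pos-+ (2 * s) (2 * s′)) ⟨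
    t ℤ.- + (2 * s + 2 * s′)             ≡⟨ cong (λ a → t ℤ.- + a) (*-distribˡ-+ 2 s s′) ⟨
    t ℤ.- + (2 * (s + s′))               ∎
    where
    open ≡-Reasoning
    lemma : ∀ t a b → (t ℤ.- a) ℤ.- b ≡ t ℤ.- (a ℤ.+ b)
    lemma = solve-∀

  t-0≡t : ∀ t → t ℤ.- + (2 * 0) ≡ t
  t-0≡t = ℤ.+-identityʳ

  t≤K⇒t-2[1+K]<0 : ∀ {t} K → t ℤ.≤ + K → t ℤ.- + (2 * suc K) ℤ.< + 0
  t≤K⇒t-2[1+K]<0 {t} K t≤K =
    subst (t ℤ.- + (2 * suc K) ℤ.<_) (ℤ.+-inverseʳ (+ (2 * suc K)))
          (ℤ.+-monoˡ-< (ℤ.- + (2 * suc K)) (ℤ.≤-<-trans t≤K (ℤ.+<+ (≤-trans (n<1+n K) (m≤m+n (suc K) _)))))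

  module Unroll (X Y : ℕ → ℤ → ℕ) (X-suc : ∀ n t → X (suc n) t ≡ X n (t ℤ.- + 2) + Y n t) where

    unroll : ∀ K M t → K ≤ M →
      X (suc M) t ≡ ∑[ s < suc K ] Y (M ∸ s) (t ℤ.- + (2 * s)) + X (M ∸ K) (t ℤ.- + (2 * suc K))
    unroll zero M t _ = begin
      X (suc M) t                                          ≡⟨ X-suc M t ⟩
      X M (t ℤ.- + 2) + Y M t                              ≡⟨ +-comm _ (Y M t) ⟩
      Y M t + X M (t ℤ.- + 2)                              ≡⟨ cong (λ u → Y M u + X M (t ℤ.- + 2)) (t-0≡t t) ⟨
      Y M (t ℤ.- + 0) + X M (t ℤ.- + 2)                    ≡⟨ cong (_+ X M (t ℤ.- + 2)) (+-identityʳ _) ⟨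
      (Y M (t ℤ.- + 0) + 0) + X M (t ℤ.- + 2)              ∎
      where open ≡-Reasoning
    unroll (suc K) (suc M) t (s≤s K≤M) = begin
      X (suc (suc M)) t
        ≡⟨ X-suc (suc M) t ⟩
      X (suc M) (t ℤ.- + 2) + Y (suc M) t
        ≡⟨ cong (_+ Y (suc M) t) (unroll K M (t ℤ.- + 2) K≤M) ⟩
      (∑[ s < suc K ] Y (M ∸ s) ((t ℤ.- + 2) ℤ.- + (2 * s)) + X (M ∸ K) ((t ℤ.- + 2) ℤ.- + (2 * suc K)))
        + Y (suc M) t
        ≡⟨ cong₂ (λ a b → (a + b) + Y (suc M) t)
                 (∑<-cong (suc K) (λ s _ → cong (Y (M ∸ s)) (t-2-2s≡t-2[1+s] t s)))
                 (cong (X (M ∸ K)) (t-2-2s≡t-2[1+s] t (suc K))) ⟩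
      (∑[ s < suc K ] Y (M ∸ s) (t ℤ.- + (2 * suc s)) + X (M ∸ K) (t ℤ.- + (2 * suc (suc K))))
        + Y (suc M) t
        ≡⟨ lemma _ _ (Y (suc M) t) ⟩
      (Y (suc M) t + ∑[ s < suc K ] Y (M ∸ s) (t ℤ.- + (2 * suc s))) + X (M ∸ K) (t ℤ.- + (2 * suc (suc K)))
        ≡⟨ cong (λ u → (Y (suc M) u + ∑[ s < suc K ] Y (M ∸ s) (t ℤ.- + (2 * suc s)))
                         + X (M ∸ K) (t ℤ.- + (2 * suc (suc K)))) (t-0≡t t) ⟨
      ∑[ s < suc (suc K) ] Y (suc M ∸ s) (t ℤ.- + (2 * s)) + X (M ∸ K) (t ℤ.- + (2 * suc (suc K)))
        ∎
      where
      open ≡-Reasoning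
      lemma : ∀ a b c → (a + b) + c ≡ (c + a) + b
      lemma a b c = trans (+-comm (a + b) c) (sym (+-assoc c a b))

  ∑<-triangle : ∀ K (a : ℕ → ℕ) → ∑[ s < suc K ] ∑[ s′ < suc (K ∸ s) ] a (s + s′) ≡ ∑[ u < suc K ] (suc u * a u)
  ∑<-triangle zero    a = refl
  ∑<-triangle (suc K) a = begin
    ∑< (suc (suc K)) a + ∑[ s < suc K ] ∑[ s′ < suc (K ∸ s) ] a (suc (s + s′))
      ≡⟨ cong (_+_ (∑< (suc (suc K)) a)) (∑<-triangle K (a ∘ suc)) ⟩
    (a 0 + ∑< (suc K) (a ∘ suc)) + ∑[ u < suc K ] (suc u * a (suc u))
      ≡⟨ +-assoc (a 0) _ _ ⟩
    a 0 + (∑< (suc K) (a ∘ suc) + ∑[ u < suc K ] (suc u * a (suc u)))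
      ≡⟨ cong₂ _+_ (+-identityʳ (a 0)) (∑<-distrib-+ (suc K) (a ∘ suc) (λ u → suc u * a (suc u))) ⟨
    ∑[ u < suc (suc K) ] (suc u * a u) ∎
    where open ≡-Reasoning

  f#-unfold : ∀ K M t → K ≤ M → t ℤ.- + (2 * suc K) ℤ.< + 0 →
    f# (suc M) t ≡ ∑[ s < suc K ] j# (M ∸ s) (t ℤ.- + (2 * s))
  f#-unfold K M t K≤M t<2[1+K] = begin
    f# (suc M) t
      ≡⟨ Unroll.unroll f# j# f#-suc K M t K≤M ⟩
    ∑[ s < suc K ] j# (M ∸ s) (t ℤ.- + (2 * s)) + f# (M ∸ K) (t ℤ.- + (2 * suc K))
      ≡⟨ cong (_+_ (∑[ s < suc K ] j# (M ∸ s) (t ℤ.- + (2 * s)))) (f#-neg (M ∸ K) _ t<2[1+K]) ⟩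
    ∑[ s < suc K ] j# (M ∸ s) (t ℤ.- + (2 * s)) + 0
      ≡⟨ +-identityʳ _ ⟩
    ∑[ s < suc K ] j# (M ∸ s) (t ℤ.- + (2 * s)) ∎
    where open ≡-Reasoning

  ℓ#-unfold : ∀ K M t → K ≤ M → t ℤ.≤ + K →
    ℓ# (suc (suc M)) t ≡ ∑[ u < suc K ] (suc u * j# (M ∸ u) (t ℤ.- + (2 * u)))
  ℓ#-unfold K M t K≤M t≤K = begin
    ℓ# (suc (suc M)) t
      ≡⟨ Unroll.unroll ℓ# f# ℓ#-suc K (suc M) t (m≤n⇒m≤1+n K≤M) ⟩
    ∑[ s < suc K ] f# (suc M ∸ s) (t ℤ.- + (2 * s)) + ℓ# (suc M ∸ K) (t ℤ.- + (2 * suc K))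
      ≡⟨ cong₂ _+_ (∑<-cong (suc K) inner)
                   (trans (cong (λ n → ℓ# n (t ℤ.- + (2 * suc K))) (+-∸-assoc 1 K≤M)) (ℓ#-neg (M ∸ K) _ (t≤K⇒t-2[1+K]<0 K t≤K))) ⟩
    ∑[ s < suc K ] ∑[ s′ < suc (K ∸ s) ] j# (M ∸ (s + s′)) (t ℤ.- + (2 * (s + s′))) + 0
      ≡⟨ +-identityʳ _ ⟩
    ∑[ s < suc K ] ∑[ s′ < suc (K ∸ s) ] j# (M ∸ (s + s′)) (t ℤ.- + (2 * (s + s′)))
      ≡⟨ ∑<-triangle K (λ u → j# (M ∸ u) (t ℤ.- + (2 * u))) ⟩
    ∑[ u < suc K ] (suc u * j# (M ∸ u) (t ℤ.- + (2 * u))) ∎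
    where
    open ≡-Reasoning
    inner : ∀ s → s < suc K →
      f# (suc M ∸ s) (t ℤ.- + (2 * s)) ≡ ∑[ s′ < suc (K ∸ s) ] j# (M ∸ (s + s′)) (t ℤ.- + (2 * (s + s′)))
    inner s (s≤s s≤K) = begin
      f# (suc M ∸ s) (t ℤ.- + (2 * s))
        ≡⟨ cong (λ n → f# n (t ℤ.- + (2 * s))) (+-∸-assoc 1 (≤-trans s≤K K≤M)) ⟩
      f# (suc (M ∸ s)) (t ℤ.- + (2 * s))
        ≡⟨ f#-unfold (K ∸ s) (M ∸ s) _ (∸-monoˡ-≤ s K≤M) t-2s<2[1+K-s] ⟩
      ∑[ s′ < suc (K ∸ s) ] j# (M ∸ s ∸ s′) ((t ℤ.- + (2 * s)) ℤ.- + (2 * s′))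
        ≡⟨ ∑<-cong (suc (K ∸ s)) (λ s′ _ → cong₂ j# (∸-+-assoc M s s′) (t-2s-2s′≡t-2[s+s′] t s s′)) ⟩
      ∑[ s′ < suc (K ∸ s) ] j# (M ∸ (s + s′)) (t ℤ.- + (2 * (s + s′))) ∎
      where
      t-2s<2[1+K-s] : (t ℤ.- + (2 * s)) ℤ.- + (2 * suc (K ∸ s)) ℤ.< + 0
      t-2s<2[1+K-s] = subst (ℤ._< + 0)
        (trans (cong (λ u → t ℤ.- + (2 * u)) (trans (cong suc (sym (m+[n∸m]≡n s≤K))) (sym (+-suc s (K ∸ s)))))
               (sym (t-2s-2s′≡t-2[s+s′] t s (suc (K ∸ s)))))
        (t≤K⇒t-2[1+K]<0 K t≤K)

module MissingDifferences where

  open import Data.Bool using (Bool; true; false; _∧_; not)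
  open import Data.Nat
  open import Data.Nat.Induction using (<-rec)
  open import Data.Nat.Properties
  open import Data.Nat.Tactic.RingSolver using (solve-∀)
  open import Data.Product using (_×_; _,_; ∃-syntax)
  open import Data.Vec using (Vec; []; _∷_; _++_)
  open import Relation.Binary.PropositionalEquality
  open import Relation.Nullary using (yes; no)
  open Sums
  open Differences

  #missing : ℕ → ℕ → ℕ
  #missing N d = ∑ₛ N (λ T → 𝟙 (not (hasDiff T d)))

  #missing≤2^ : ∀ N d → #missing N d ≤ 2 ^ N
  #missing≤2^ N d = begin
    #missing N d           ≤⟨ ∑ₛ-mono-≤ N (λ T → 𝟙≤1 (not (hasDiff T d))) ⟩
    ∑ₛ N (λ _ → 1)         ≡⟨ ∑ₛ-const N 1 ⟩
    2 ^ N * 1              ≡⟨ *-identityʳ (2 ^ N) ⟩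
    2 ^ N                  ∎
    where open ≤-Reasoning

  disjoint : ∀ {c} → Vec Bool c → Vec Bool c → Bool
  disjoint []      []      = true
  disjoint (a ∷ U) (b ∷ V) = not (a ∧ b) ∧ disjoint U V

  disjoint≡false⇒ : ∀ {c} (U V : Vec Bool c) → disjoint U V ≡ false → ∃[ x ] (x < c × x ∈ᵇ U ≡ true × x ∈ᵇ V ≡ true)
  disjoint≡false⇒ []          []          ()
  disjoint≡false⇒ (true ∷ U)  (true ∷ V)  _ = 0 , z<s , refl , refl
  disjoint≡false⇒ (true ∷ U)  (false ∷ V) h with x , x<c , x∈U , x∈V ← disjoint≡false⇒ U V h = suc x , s<s x<c , x∈U , x∈V
  disjoint≡false⇒ (false ∷ U) (b ∷ V)     h with x , x<c , x∈U , x∈V ← disjoint≡false⇒ U V h = suc x , s<s x<c , x∈U , x∈V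

  #disjointPairs : ∀ c → ∑ₛ c (λ U → ∑ₛ c (λ V → 𝟙 (disjoint U V))) ≡ 3 ^ c
  #disjointPairs zero    = refl
  #disjointPairs (suc c) = begin
    ∑ₛ c (λ U → D U + D U) + ∑ₛ c (λ U → D U + ∑ₛ c (λ _ → 0))
      ≡⟨ cong₂ _+_ (∑ₛ-distrib-+ c D D) (∑ₛ-cong c (λ U → trans (cong (D U +_) (∑ₛ-zero c)) (+-identityʳ (D U)))) ⟩
    (∑ₛ c D + ∑ₛ c D) + ∑ₛ c D
      ≡⟨ cong (λ x → (x + x) + x) (#disjointPairs c) ⟩
    (3 ^ c + 3 ^ c) + 3 ^ c
      ≡⟨ x+x+x≡3*x (3 ^ c) ⟩
    3 ^ suc c ∎
    where
    open ≡-Reasoning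
    D : Vec Bool c → ℕ
    D U = ∑ₛ c (λ V → 𝟙 (disjoint U V))
    x+x+x≡3*x : ∀ x → (x + x) + x ≡ 3 * x
    x+x+x≡3*x = solve-∀

  hasDiff-++⁺ʳ : ∀ {m n} (U : Vec Bool m) (V : Vec Bool n) d → hasDiff V d ≡ true → hasDiff (U ++ V) d ≡ true
  hasDiff-++⁺ʳ {m} {n} U V d h with y , y<n , h′ ← any<-elim n h with y∈V , y+d∈V ← ∧≡true⇒ h′ =
    any<-intro (m + n) (m + y) (+-monoʳ-< m y<n)
      (∧≡true⇐ (trans (∈ᵇ-++ʳ U V y) y∈V)
               (trans (cong (_∈ᵇ (U ++ V)) (+-assoc m y d)) (trans (∈ᵇ-++ʳ U V (y + d)) y+d∈V)))

  hasDiff-overlap : ∀ {c e r} (U₁ : Vec Bool c) (M : Vec Bool e) (U₂ : Vec Bool c) (V : Vec Bool r) x →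
    x < c → x ∈ᵇ U₁ ≡ true → x ∈ᵇ U₂ ≡ true → hasDiff (U₁ ++ (M ++ (U₂ ++ V))) (c + e) ≡ true
  hasDiff-overlap {c} {e} {r} U₁ M U₂ V x x<c x∈U₁ x∈U₂ =
    any<-intro (c + (e + (c + r))) x (<-≤-trans x<c (m≤m+n c _))
      (∧≡true⇐ (trans (∈ᵇ-++ˡ U₁ _ x<c) x∈U₁) (begin
        (x + (c + e)) ∈ᵇ (U₁ ++ (M ++ (U₂ ++ V)))   ≡⟨ cong (_∈ᵇ (U₁ ++ (M ++ (U₂ ++ V)))) (x+[c+e]≡c+[e+x] x c e) ⟩
        (c + (e + x)) ∈ᵇ (U₁ ++ (M ++ (U₂ ++ V)))   ≡⟨ ∈ᵇ-++ʳ U₁ _ (e + x) ⟩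
        (e + x) ∈ᵇ (M ++ (U₂ ++ V))                 ≡⟨ ∈ᵇ-++ʳ M _ x ⟩
        x ∈ᵇ (U₂ ++ V)                              ≡⟨ ∈ᵇ-++ˡ U₂ V x<c ⟩
        x ∈ᵇ U₂                                     ≡⟨ x∈U₂ ⟩
        true                                        ∎))
    where
    open ≡-Reasoning
    x+[c+e]≡c+[e+x] : ∀ x c e → x + (c + e) ≡ c + (e + x)
    x+[c+e]≡c+[e+x] = solve-∀

  𝟙-missing-blocks : ∀ {c e r} (U₁ : Vec Bool c) (M : Vec Bool e) (U₂ : Vec Bool c) (V : Vec Bool r) →
    𝟙 (not (hasDiff (U₁ ++ (M ++ (U₂ ++ V))) (c + e))) ≤ 𝟙 (disjoint U₁ U₂) * 𝟙 (not (hasDiff V (c + e)))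
  𝟙-missing-blocks {c} {e} U₁ M U₂ V
    with hasDiff (U₁ ++ (M ++ (U₂ ++ V))) (c + e) in T-has | disjoint U₁ U₂ in U-disj | hasDiff V (c + e) in V-has
  ... | true  | _     | _     = z≤n
  ... | false | true  | false = ≤-refl
  ... | false | false | _ with x , x<c , x∈U₁ , x∈U₂ ← disjoint≡false⇒ U₁ U₂ U-disj
    with () ← trans (sym T-has) (hasDiff-overlap U₁ M U₂ V x x<c x∈U₁ x∈U₂)
  ... | false | true  | true
    with () ← trans (sym T-has) (hasDiff-++⁺ʳ U₁ _ (c + e) (hasDiff-++⁺ʳ M _ (c + e) (hasDiff-++⁺ʳ U₂ V (c + e) V-has)))

  #missing-blocks : ∀ c e r → #missing (c + (e + (c + r))) (c + e) ≤ 2 ^ e * (3 ^ c * #missing r (c + e))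
  #missing-blocks c e r = begin
    #missing (c + (e + (c + r))) d
      ≡⟨ trans (∑ₛ-++ c (e + (c + r)) _) (∑ₛ-cong c (λ U₁ → trans (∑ₛ-++ e (c + r) _) (∑ₛ-cong e (λ M → ∑ₛ-++ c r _)))) ⟩
    ∑ₛ c (λ U₁ → ∑ₛ e (λ M → ∑ₛ c (λ U₂ → ∑ₛ r (λ V → 𝟙 (not (hasDiff (U₁ ++ (M ++ (U₂ ++ V))) d))))))
      ≤⟨ ∑ₛ-mono-≤ c (λ U₁ → ∑ₛ-mono-≤ e (λ M → ∑ₛ-mono-≤ c (λ U₂ → ∑ₛ-mono-≤ r (𝟙-missing-blocks U₁ M U₂)))) ⟩
    ∑ₛ c (λ U₁ → ∑ₛ e (λ M → ∑ₛ c (λ U₂ → ∑ₛ r (λ V → 𝟙 (disjoint U₁ U₂) * 𝟙 (not (hasDiff V d))))))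
      ≡⟨ ∑ₛ-cong c (λ U₁ → ∑ₛ-cong e (λ M → trans (∑ₛ-cong c (λ U₂ → ∑ₛ-distribˡ-* r (𝟙 (disjoint U₁ U₂)) _))
                                                  (∑ₛ-distribʳ-* c (#missing r d) (λ U₂ → 𝟙 (disjoint U₁ U₂))))) ⟩
    ∑ₛ c (λ U₁ → ∑ₛ e (λ M → ∑ₛ c (λ U₂ → 𝟙 (disjoint U₁ U₂)) * #missing r d))
      ≡⟨ ∑ₛ-cong c (λ U₁ → ∑ₛ-const e _) ⟩
    ∑ₛ c (λ U₁ → 2 ^ e * (∑ₛ c (λ U₂ → 𝟙 (disjoint U₁ U₂)) * #missing r d))
      ≡⟨ ∑ₛ-distribˡ-* c (2 ^ e) _ ⟩
    2 ^ e * ∑ₛ c (λ U₁ → ∑ₛ c (λ U₂ → 𝟙 (disjoint U₁ U₂)) * #missing r d)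
      ≡⟨ cong (2 ^ e *_) (trans (∑ₛ-distribʳ-* c (#missing r d) _) (cong (_* #missing r d) (#disjointPairs c))) ⟩
    2 ^ e * (3 ^ c * #missing r d) ∎
    where
    open ≤-Reasoning
    d = c + e

  3^d*8^[d+s]≤4^d*7^[d+s] : ∀ d s → s ≤ d → 3 ^ d * 8 ^ (d + s) ≤ 4 ^ d * 7 ^ (d + s)
  3^d*8^[d+s]≤4^d*7^[d+s] zero    zero    _ = ≤-refl
  3^d*8^[d+s]≤4^d*7^[d+s] (suc d) zero    _ = begin
    3 * 3 ^ d * (8 * 8 ^ (d + 0))   ≡⟨ lemma₁ (3 ^ d) (8 ^ (d + 0)) ⟩
    24 * (3 ^ d * 8 ^ (d + 0))      ≤⟨ *-mono-≤ (m≤m+n 24 4) (3^d*8^[d+s]≤4^d*7^[d+s] d zero z≤n) ⟩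
    28 * (4 ^ d * 7 ^ (d + 0))      ≡⟨ lemma₂ (4 ^ d) (7 ^ (d + 0)) ⟨
    4 * 4 ^ d * (7 * 7 ^ (d + 0))   ∎
    where
    open ≤-Reasoning
    lemma₁ : ∀ x y → 3 * x * (8 * y) ≡ 24 * (x * y)
    lemma₁ = solve-∀
    lemma₂ : ∀ x y → 4 * x * (7 * y) ≡ 28 * (x * y)
    lemma₂ = solve-∀
  3^d*8^[d+s]≤4^d*7^[d+s] (suc d) (suc s) (s≤s s≤d) rewrite +-suc d s = begin
    3 * 3 ^ d * (8 * (8 * 8 ^ (d + s)))   ≡⟨ lemma₁ (3 ^ d) (8 ^ (d + s)) ⟩
    192 * (3 ^ d * 8 ^ (d + s))           ≤⟨ *-mono-≤ (m≤m+n 192 4) (3^d*8^[d+s]≤4^d*7^[d+s] d s s≤d) ⟩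
    196 * (4 ^ d * 7 ^ (d + s))           ≡⟨ lemma₂ (4 ^ d) (7 ^ (d + s)) ⟨
    4 * 4 ^ d * (7 * (7 * 7 ^ (d + s)))   ∎
    where
    open ≤-Reasoning
    lemma₁ : ∀ x y → 3 * x * (8 * (8 * y)) ≡ 192 * (x * y)
    lemma₁ = solve-∀
    lemma₂ : ∀ x y → 4 * x * (7 * (7 * y)) ≡ 196 * (x * y)
    lemma₂ = solve-∀

  4^n≡2^[n+n] : ∀ n → 4 ^ n ≡ 2 ^ (n + n)
  4^n≡2^[n+n] n = trans (^-*-assoc 2 2 n) (cong (λ m → 2 ^ (n + m)) (+-identityʳ n))

  -- One pair of disjoint blocks of length D costs a factor (3/4)^D ≤ (7/8)^(D+s).
  decay-step : ∀ {N k} D s a b X Y → D + s + a ≡ k → D + D + b ≡ N → s ≤ D →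
    Y ≤ 3 ^ D * X → X * 8 ^ a ≤ 2 ^ b * 7 ^ a → Y * 8 ^ k ≤ 2 ^ N * 7 ^ k
  decay-step D s a b X Y refl refl s≤D Y≤3^DX X-decay = begin
    Y * 8 ^ (D + s + a)                        ≡⟨ cong (Y *_) (^-distribˡ-+-* 8 (D + s) a) ⟩
    Y * (8 ^ (D + s) * 8 ^ a)                  ≤⟨ *-monoˡ-≤ _ Y≤3^DX ⟩
    3 ^ D * X * (8 ^ (D + s) * 8 ^ a)          ≡⟨ interchange (3 ^ D) X (8 ^ (D + s)) (8 ^ a) ⟩
    (3 ^ D * 8 ^ (D + s)) * (X * 8 ^ a)        ≤⟨ *-mono-≤ (3^d*8^[d+s]≤4^d*7^[d+s] D s s≤D) X-decay ⟩
    (4 ^ D * 7 ^ (D + s)) * (2 ^ b * 7 ^ a)    ≡⟨ cong (λ x → (x * 7 ^ (D + s)) * (2 ^ b * 7 ^ a)) (4^n≡2^[n+n] D) ⟩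
    (2 ^ (D + D) * 7 ^ (D + s)) * (2 ^ b * 7 ^ a)
                                               ≡⟨ interchange (2 ^ (D + D)) (7 ^ (D + s)) (2 ^ b) (7 ^ a) ⟩
    (2 ^ (D + D) * 2 ^ b) * (7 ^ (D + s) * 7 ^ a)
                                               ≡⟨ cong₂ _*_ (^-distribˡ-+-* 2 (D + D) b) (^-distribˡ-+-* 7 (D + s) a) ⟨
    2 ^ (D + D + b) * 7 ^ (D + s + a)          ∎
    where
    open ≤-Reasoning
    interchange : ∀ x y z w → x * y * (z * w) ≡ (x * z) * (y * w)
    interchange = solve-∀

  #missing-blocks′ : ∀ {N d} c e r → d ≡ c + e → N ≡ c + (e + (c + r)) → #missing N d ≤ 2 ^ e * (3 ^ c * #missing r d)
  #missing-blocks′ c e r refl refl = #missing-blocks c e r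

  -- Recursion on c: the blocks [0, d) and [d, 2d) must be disjoint and [2d, d + c) must miss d as well;
  -- if c < d, only the blocks [0, c) and [d, d + c) are used.
  #missing-decay : ∀ d .{{_ : NonZero d}} c → #missing (d + c) d * 8 ^ c ≤ 2 ^ (d + c) * 7 ^ c
  #missing-decay d = <-rec _ go
    where
    go : ∀ c → (∀ {c′} → c′ < c → #missing (d + c′) d * 8 ^ c′ ≤ 2 ^ (d + c′) * 7 ^ c′) →
         #missing (d + c) d * 8 ^ c ≤ 2 ^ (d + c) * 7 ^ c
    go c rec with d ≤? c
    ... | no d≰c =
      decay-step c 0 0 e (2 ^ e) (#missing (d + c) d) (c+0+0≡c c) (trans (c+c+e≡[c+e]+c c e) (cong (_+ c) c+e≡d)) z≤n
        (≤-trans (#missing-blocks′ c e 0 (sym c+e≡d) (trans (cong (_+ c) (sym c+e≡d)) ([c+e]+c≡c+[e+[c+0]] c e)))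
                 (≤-reflexive (x*[y*1]≡y*x (2 ^ e) (3 ^ c))))
        ≤-refl
      where
      e = d ∸ c
      c+e≡d : c + e ≡ d
      c+e≡d = m+[n∸m]≡n (<⇒≤ (≰⇒> d≰c))
      c+0+0≡c : ∀ c → c + 0 + 0 ≡ c
      c+0+0≡c = solve-∀
      c+c+e≡[c+e]+c : ∀ c e → c + c + e ≡ (c + e) + c
      c+c+e≡[c+e]+c = solve-∀
      [c+e]+c≡c+[e+[c+0]] : ∀ c e → (c + e) + c ≡ c + (e + (c + 0))
      [c+e]+c≡c+[e+[c+0]] = solve-∀
      x*[y*1]≡y*x : ∀ x y → x * (y * 1) ≡ y * x
      x*[y*1]≡y*x = solve-∀
    ... | yes d≤c with R , refl ← m≤n⇒∃[o]m+o≡n d≤c with d ≤? R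
    ...   | no d≰R =
      decay-step d R 0 R (#missing R d) (#missing (d + (d + R)) d) (+-identityʳ (d + R)) (+-assoc d d R)
        (<⇒≤ (≰⇒> d≰R)) Y≤3^dX (*-monoˡ-≤ 1 (#missing≤2^ R d))
      where
      Y≤3^dX : #missing (d + (d + R)) d ≤ 3 ^ d * #missing R d
      Y≤3^dX = ≤-trans (#missing-blocks′ d 0 R (sym (+-identityʳ d)) refl) (≤-reflexive (+-identityʳ _))
    ...   | yes d≤R with c′ , refl ← m≤n⇒∃[o]m+o≡n d≤R =
      decay-step d d c′ (d + c′) (#missing (d + c′) d) (#missing (d + (d + (d + c′))) d) (+-assoc d d c′) (+-assoc d d (d + c′))
        ≤-refl Y≤3^dX (rec c′<c)
      where
      Y≤3^dX : #missing (d + (d + (d + c′))) d ≤ 3 ^ d * #missing (d + c′) d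
      Y≤3^dX = ≤-trans (#missing-blocks′ d 0 (d + c′) (sym (+-identityʳ d)) refl) (≤-reflexive (+-identityʳ _))
      c′<c : c′ < d + (d + c′)
      c′<c = <-≤-trans (m<n+m c′ (>-nonZero⁻¹ d)) (m≤n+m (d + c′) d)

  ∑<-geometric : ∀ p L (x : ℕ → ℕ) Y → (∀ v → v < L → x v * suc p ^ v ≤ Y * p ^ v) → ∑< L x ≤ suc p * Y
  ∑<-geometric p L x Y x-decay =
    *-cancelʳ-≤ (∑< L x) (q * Y) (q ^ L) {{m^n≢0 q L}} (≤-trans (m≤m+n _ _) (invariant L x-decay))
    where
    q = suc p
    invariant : ∀ L → (∀ v → v < L → x v * q ^ v ≤ Y * p ^ v) → ∑< L x * q ^ L + q * Y * p ^ L ≤ q * Y * q ^ L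
    invariant zero    _       = ≤-refl
    invariant (suc L) x-decay = begin
      ∑< (suc L) x * q ^ suc L + q * Y * p ^ suc L
        ≡⟨ cong (λ s → s * q ^ suc L + q * Y * p ^ suc L) (∑<-suc L x) ⟩
      (∑< L x + x L) * (q * q ^ L) + q * Y * (p * p ^ L)
        ≡⟨ lemma₁ p (∑< L x) (x L) (q ^ L) Y (p ^ L) ⟩
      q * (∑< L x * q ^ L) + q * (x L * q ^ L) + q * p * (Y * p ^ L)
        ≤⟨ +-monoˡ-≤ _ (+-monoʳ-≤ (q * (∑< L x * q ^ L)) (*-monoʳ-≤ q (x-decay L ≤-refl))) ⟩
      q * (∑< L x * q ^ L) + q * (Y * p ^ L) + q * p * (Y * p ^ L)
        ≡⟨ lemma₂ p (∑< L x * q ^ L) Y (p ^ L) ⟩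
      q * (∑< L x * q ^ L + q * Y * p ^ L)
        ≤⟨ *-monoʳ-≤ q (invariant L (λ v v<L → x-decay v (m<n⇒m<1+n v<L))) ⟩
      q * (q * Y * q ^ L)
        ≡⟨ lemma₃ q Y (q ^ L) ⟩
      q * Y * (q * q ^ L) ∎
      where
      open ≤-Reasoning
      lemma₁ : ∀ p s a Q y P → (s + a) * (suc p * Q) + suc p * y * (p * P)
                              ≡ suc p * (s * Q) + suc p * (a * Q) + suc p * p * (y * P)
      lemma₁ = solve-∀
      lemma₂ : ∀ p a y P → suc p * a + suc p * (y * P) + suc p * p * (y * P) ≡ suc p * (a + suc p * y * P)
      lemma₂ = solve-∀
      lemma₃ : ∀ q y Q → q * (q * y * Q) ≡ q * y * (q * Q)
      lemma₃ = solve-∀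

module Stabilisation where

  open import Data.Bool using (Bool; true; false; _∧_; _∨_; not)
  open import Data.Bool.Properties using (∧-zeroʳ; ∨-identityʳ)
  open import Data.Integer as ℤ using (ℤ; +_)
  import Data.Integer.Properties as ℤ
  import Data.Integer.Tactic.RingSolver as ℤ-Solver
  open import Data.Nat
  open import Data.Nat.Properties
  open import Data.Nat.Tactic.RingSolver using (solve-∀)
  open import Data.Vec using (Vec; _∷_; _∷ʳ_; _++_)
  open import Function using (_∘_)
  open import Relation.Binary.PropositionalEquality
  open import Relation.Nullary using (does)
  open import Defs
  open Sums
  open Differences
  open Recurrences
  open MissingDifferences

  -- Positions 0‥h and h+m+1‥2h+m+1 of withEnds (A ++ (M ++ W)) hold true ∷ A and W ∷ʳ true.
  crossDiff : ∀ {h} → Vec Bool h → Vec Bool h → ℕ → Bool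
  crossDiff {h} A W c = any< (suc h) (λ x → x ∈ᵇ (true ∷ A) ∧ (x + c) ∈ᵇ (W ∷ʳ true))

  #crossDiffs : ∀ {h} → Vec Bool h → Vec Bool h → ℕ
  #crossDiffs {h} A W = count< (suc (suc h)) (crossDiff A W)

  hasDiff-withEnds-long : ∀ h m (A : Vec Bool h) (M : Vec Bool m) (W : Vec Bool h) c →
    hasDiff (withEnds (A ++ (M ++ W))) (suc ((h + m) + c)) ≡ crossDiff A W c
  hasDiff-withEnds-long h m A M W c = begin
    any< (suc (suc (h + (m + h)))) p
      ≡⟨ cong (λ k → any< k p) (cong suc (sym (+-suc h (m + h)))) ⟩
    any< (suc h + suc (m + h)) p
      ≡⟨ any<-split (suc h) (suc (m + h)) p ⟩
    any< (suc h) p ∨ any< (suc (m + h)) (λ i → p (suc h + i))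
      ≡⟨ cong₂ _∨_ (any<-cong (suc h) early) (any<-false (suc (m + h)) late) ⟩
    crossDiff A W c ∨ false
      ≡⟨ ∨-identityʳ _ ⟩
    crossDiff A W c ∎
    where
    open ≡-Reasoning
    T = withEnds (A ++ (M ++ W))
    d = suc ((h + m) + c)
    p : ℕ → Bool
    p x = x ∈ᵇ T ∧ (x + d) ∈ᵇ T
    x+d≡1+h+[m+[x+c]] : ∀ x → x + d ≡ suc (h + (m + (x + c)))
    x+d≡1+h+[m+[x+c]] x = lemma x h m c
      where
      lemma : ∀ x h m c → x + suc ((h + m) + c) ≡ suc (h + (m + (x + c)))
      lemma = solve-∀
    x+d∈T : ∀ x → (x + d) ∈ᵇ T ≡ (x + c) ∈ᵇ (W ∷ʳ true)
    x+d∈T x = begin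
      (x + d) ∈ᵇ T                                          ≡⟨ cong (_∈ᵇ T) (x+d≡1+h+[m+[x+c]] x) ⟩
      (h + (m + (x + c))) ∈ᵇ ((A ++ (M ++ W)) ∷ʳ true)      ≡⟨ ∈ᵇ-++-∷ʳʳ A (M ++ W) true (m + (x + c)) ⟩
      (m + (x + c)) ∈ᵇ ((M ++ W) ∷ʳ true)                   ≡⟨ ∈ᵇ-++-∷ʳʳ M W true (x + c) ⟩
      (x + c) ∈ᵇ (W ∷ʳ true)                                ∎
    early : ∀ x → x < suc h → p x ≡ x ∈ᵇ (true ∷ A) ∧ (x + c) ∈ᵇ (W ∷ʳ true)
    early zero    _         = x+d∈T zero
    early (suc x) (s≤s x<h) = cong₂ _∧_ (∈ᵇ-++-∷ʳˡ A (M ++ W) true x<h) (x+d∈T (suc x))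
    late : ∀ i → i < suc (m + h) → p (suc h + i) ≡ false
    late i _ = trans (cong (_ ∧_) (∈ᵇ-outside T N≤)) (∧-zeroʳ _)
      where
      N≤ : suc (suc (h + (m + h))) ≤ suc h + i + d
      N≤ = subst (suc (suc (h + (m + h))) ≤_) (lemma h m i c) (m≤m+n _ (i + c))
        where
        lemma : ∀ h m i c → suc (suc (h + (m + h))) + (i + c) ≡ suc h + i + suc ((h + m) + c)
        lemma = solve-∀

  Good : ∀ h m → Vec Bool (h + (m + h)) → Bool
  Good h m S = all< (h + m) (λ i → hasDiff (withEnds S) (suc i))

  private
    +a-1-+c≡+b-+d : ∀ a b c d → a + d ≡ (b + c) + 1 → (+ a ℤ.- + 1) ℤ.- + c ≡ + b ℤ.- + d
    +a-1-+c≡+b-+d a b c d eq = begin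
      (+ a ℤ.- + 1) ℤ.- + c                                 ≡⟨ lemma₁ (+ a) (+ c) (+ d) ⟩
      (((+ a ℤ.+ + d) ℤ.- + 1) ℤ.- + c) ℤ.- + d             ≡⟨ cong (λ z → ((z ℤ.- + 1) ℤ.- + c) ℤ.- + d) eq′ ⟩
      ((((+ b ℤ.+ + c) ℤ.+ + 1) ℤ.- + 1) ℤ.- + c) ℤ.- + d   ≡⟨ lemma₂ (+ b) (+ c) (+ d) ⟩
      + b ℤ.- + d                                           ∎
      where
      open ≡-Reasoning
      eq′ : + a ℤ.+ + d ≡ (+ b ℤ.+ + c) ℤ.+ + 1
      eq′ = trans (sym (ℤ.pos-+ a d)) (trans (cong +_ eq) (trans (ℤ.pos-+ (b + c) 1) (cong (ℤ._+ + 1) (ℤ.pos-+ b c))))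
      lemma₁ : ∀ a c d → (a ℤ.- + 1) ℤ.- c ≡ (((a ℤ.+ d) ℤ.- + 1) ℤ.- c) ℤ.- d
      lemma₁ = ℤ-Solver.solve-∀
      lemma₂ : ∀ b c d → ((((b ℤ.+ c) ℤ.+ + 1) ℤ.- + 1) ℤ.- c) ℤ.- d ≡ b ℤ.- d
      lemma₂ = ℤ-Solver.solve-∀

  stat-good : ∀ h m (A : Vec Bool h) (M : Vec Bool m) (W : Vec Bool h) → Good h m (A ++ (M ++ W)) ≡ true →
    stat (withEnds (A ++ (M ++ W))) ≡ + (2 * suc h) ℤ.- + (2 * #crossDiffs A W)
  stat-good h m A M W good = begin
    stat T
      ≡⟨ cong (λ k → (+ (2 * N) ℤ.- + 1) ℤ.- + k) (diffCard≡ T) ⟩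
    (+ (2 * N) ℤ.- + 1) ℤ.- + (#posDiffs T + (1 + #posDiffs T))
      ≡⟨ cong (λ p → (+ (2 * N) ℤ.- + 1) ℤ.- + (p + (1 + p))) #posDiffs≡ ⟩
    (+ (2 * N) ℤ.- + 1) ℤ.- + (p + (1 + p))
      ≡⟨ +a-1-+c≡+b-+d (2 * N) (2 * suc h) (p + (1 + p)) (2 * k) (lemma h m k) ⟩
    + (2 * suc h) ℤ.- + (2 * k) ∎
    where
    open ≡-Reasoning
    T = withEnds (A ++ (M ++ W))
    N = suc (suc (h + (m + h)))
    k = #crossDiffs A W
    p = (h + m) + k
    lemma : ∀ h m k → 2 * suc (suc (h + (m + h))) + 2 * k ≡ (2 * suc h + ((h + m + k) + (1 + (h + m + k)))) + 1
    lemma = solve-∀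
    N≡[h+m]+[2+h] : ∀ h m → suc (suc (h + (m + h))) ≡ (h + m) + suc (suc h)
    N≡[h+m]+[2+h] = solve-∀
    #posDiffs≡ : #posDiffs T ≡ p
    #posDiffs≡ = begin
      count< N (λ j → hasDiff T (suc j))
        ≡⟨ cong (λ n → count< n (λ j → hasDiff T (suc j))) (N≡[h+m]+[2+h] h m) ⟩
      count< ((h + m) + suc (suc h)) (λ j → hasDiff T (suc j))
        ≡⟨ ∑<-split (h + m) (suc (suc h)) (λ j → 𝟙 (hasDiff T (suc j))) ⟩
      count< (h + m) (λ j → hasDiff T (suc j)) + count< (suc (suc h)) (λ c → hasDiff T (suc ((h + m) + c)))
        ≡⟨ cong₂ _+_ (all<⇒count<≡ (h + m) _ good)
                     (∑<-cong (suc (suc h)) (λ c _ → cong 𝟙 (hasDiff-withEnds-long h m A M W c))) ⟩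
      p ∎

  ∑ₛ³ : ∀ a b c → (Vec Bool a → Vec Bool b → Vec Bool c → ℕ) → ℕ
  ∑ₛ³ a b c F = ∑ₛ a (λ A → ∑ₛ b (λ M → ∑ₛ c (λ W → F A M W)))

  ∑ₛ³-mono-≤ : ∀ a b c {F G} → (∀ A M W → F A M W ≤ G A M W) → ∑ₛ³ a b c F ≤ ∑ₛ³ a b c G
  ∑ₛ³-mono-≤ a b c F≤G = ∑ₛ-mono-≤ a (λ A → ∑ₛ-mono-≤ b (λ M → ∑ₛ-mono-≤ c (F≤G A M)))

  ∑ₛ³-distrib-+ : ∀ a b c F G → ∑ₛ³ a b c (λ A M W → F A M W + G A M W) ≡ ∑ₛ³ a b c F + ∑ₛ³ a b c G
  ∑ₛ³-distrib-+ a b c F G =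
    trans (∑ₛ-cong a (λ A → trans (∑ₛ-cong b (λ M → ∑ₛ-distrib-+ c (F A M) (G A M))) (∑ₛ-distrib-+ b _ _)))
          (∑ₛ-distrib-+ a _ _)

  ∑ₛ-++³ : ∀ a b c (f : Vec Bool (a + (b + c)) → ℕ) → ∑ₛ (a + (b + c)) f ≡ ∑ₛ³ a b c (λ A M W → f (A ++ (M ++ W)))
  ∑ₛ-++³ a b c f = trans (∑ₛ-++ a (b + c) f) (∑ₛ-cong a (λ A → ∑ₛ-++ b c _))

  ∑ₛ³-const₂ : ∀ a b c (F : Vec Bool a → Vec Bool c → ℕ) → ∑ₛ³ a b c (λ A _ W → F A W) ≡ 2 ^ b * ∑ₛ a (λ A → ∑ₛ c (F A))
  ∑ₛ³-const₂ a b c F = trans (∑ₛ-cong a (λ A → ∑ₛ-const b _)) (∑ₛ-distribˡ-* a (2 ^ b) _)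

  G# : ℕ → ℤ → ℕ
  G# h t = ∑ₛ h (λ A → ∑ₛ h (λ W → 𝟙 (does (+ (2 * suc h) ℤ.- + (2 * #crossDiffs A W) ℤ.≟ t))))

  #bad : ℕ → ℕ → ℕ
  #bad h m = ∑ₛ (h + (m + h)) (λ S → 𝟙 (not (Good h m S)))

  module _ (h m : ℕ) (t : ℤ) where

    private
      φ : Vec Bool h → Vec Bool m → Vec Bool h → ℕ
      φ A M W = 𝟙 (hasStat (withEnds (A ++ (M ++ W))) t)
      ψ : Vec Bool h → Vec Bool m → Vec Bool h → ℕ
      ψ A _ W = 𝟙 (does (+ (2 * suc h) ℤ.- + (2 * #crossDiffs A W) ℤ.≟ t))
      β : Vec Bool h → Vec Bool m → Vec Bool h → ℕ
      β A M W = 𝟙 (not (Good h m (A ++ (M ++ W))))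

      good-or-bad : ∀ (F G : Vec Bool h → Vec Bool m → Vec Bool h → ℕ) →
        (∀ A M W → Good h m (A ++ (M ++ W)) ≡ true → F A M W ≤ G A M W) →
        (∀ A M W → F A M W ≤ 1) → ∀ A M W → F A M W ≤ G A M W + β A M W
      good-or-bad F G good⇒≤ F≤1 A M W with Good h m (A ++ (M ++ W)) in good
      ... | true  = ≤-trans (good⇒≤ A M W good) (m≤m+n _ _)
      ... | false = ≤-trans (F≤1 A M W) (m≤n+m 1 _)

      φ≡ψ : ∀ A M W → Good h m (A ++ (M ++ W)) ≡ true → φ A M W ≡ ψ A M W
      φ≡ψ A M W good = cong (λ s → 𝟙 (does (s ℤ.≟ t))) (stat-good h m A M W good)

      j#≡ : j# (h + (m + h)) t ≡ ∑ₛ³ h m h φ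
      j#≡ = ∑ₛ-++³ h m h _

      2^m*G#≡ : 2 ^ m * G# h t ≡ ∑ₛ³ h m h ψ
      2^m*G#≡ = sym (∑ₛ³-const₂ h m h _)

      #bad≡ : #bad h m ≡ ∑ₛ³ h m h β
      #bad≡ = ∑ₛ-++³ h m h _

    j#≤2^m*G#+#bad : j# (h + (m + h)) t ≤ 2 ^ m * G# h t + #bad h m
    j#≤2^m*G#+#bad = begin
      j# (h + (m + h)) t                       ≡⟨ j#≡ ⟩
      ∑ₛ³ h m h φ                              ≤⟨ ∑ₛ³-mono-≤ h m h (good-or-bad φ ψ (λ A M W → ≤-reflexive ∘ φ≡ψ A M W)
                                                                               (λ A M W → 𝟙≤1 _)) ⟩
      ∑ₛ³ h m h (λ A M W → ψ A M W + β A M W)  ≡⟨ ∑ₛ³-distrib-+ h m h ψ β ⟩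
      ∑ₛ³ h m h ψ + ∑ₛ³ h m h β                ≡⟨ cong₂ _+_ 2^m*G#≡ #bad≡ ⟨
      2 ^ m * G# h t + #bad h m                ∎
      where open ≤-Reasoning

    2^m*G#≤j#+#bad : 2 ^ m * G# h t ≤ j# (h + (m + h)) t + #bad h m
    2^m*G#≤j#+#bad = begin
      2 ^ m * G# h t                           ≡⟨ 2^m*G#≡ ⟩
      ∑ₛ³ h m h ψ                              ≤⟨ ∑ₛ³-mono-≤ h m h (good-or-bad ψ φ (λ A M W → ≤-reflexive ∘ sym ∘ φ≡ψ A M W)
                                                                               (λ A M W → 𝟙≤1 _)) ⟩
      ∑ₛ³ h m h (λ A M W → φ A M W + β A M W)  ≡⟨ ∑ₛ³-distrib-+ h m h φ β ⟩
      ∑ₛ³ h m h φ + ∑ₛ³ h m h β                ≡⟨ cong₂ _+_ j#≡ #bad≡ ⟨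
      j# (h + (m + h)) t + #bad h m            ∎
      where open ≤-Reasoning

  ∑ₛ-withEnds≤ : ∀ m (f : Vec Bool (suc (suc m)) → ℕ) → ∑ₛ m (f ∘ withEnds) ≤ ∑ₛ (suc (suc m)) f
  ∑ₛ-withEnds≤ m f = begin
    ∑ₛ m (λ S → f (true ∷ (S ∷ʳ true)))
      ≤⟨ m≤n+m _ _ ⟩
    ∑ₛ m (λ S → f (true ∷ (S ∷ʳ false))) + ∑ₛ m (λ S → f (true ∷ (S ∷ʳ true)))
      ≡⟨ ∑ₛ-∷ʳ m (f ∘ (true ∷_)) ⟨
    ∑ₛ (suc m) (f ∘ (true ∷_))
      ≤⟨ m≤n+m _ (∑ₛ (suc m) (f ∘ (false ∷_))) ⟩
    ∑ₛ (suc (suc m)) f ∎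
    where open ≤-Reasoning

  #bad≤∑#missing : ∀ h m → #bad h m ≤ ∑[ i < h + m ] #missing (suc (suc (h + (m + h)))) (suc i)
  #bad≤∑#missing h m = begin
    #bad h m
      ≤⟨ ∑ₛ-mono-≤ M (λ S → 𝟙[¬all<]≤count<¬ (h + m) (λ i → hasDiff (withEnds S) (suc i))) ⟩
    ∑ₛ M (λ S → ∑[ i < h + m ] 𝟙 (not (hasDiff (withEnds S) (suc i))))
      ≡⟨ ∑ₛ-∑<-comm M (h + m) (λ S i → 𝟙 (not (hasDiff (withEnds S) (suc i)))) ⟩
    ∑[ i < h + m ] ∑ₛ M (λ S → 𝟙 (not (hasDiff (withEnds S) (suc i))))
      ≤⟨ ∑<-mono-≤ (h + m) (λ i _ → ∑ₛ-withEnds≤ M (λ T → 𝟙 (not (hasDiff T (suc i))))) ⟩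
    ∑[ i < h + m ] #missing (suc (suc M)) (suc i) ∎
    where
    open ≤-Reasoning
    M = h + (m + h)

  -- Bad sets are rare: the union bound over d and P(d ∉ T - T) ≤ (7/8)^(N - d) with N - d ≥ h + 2.
  #bad-bound : ∀ h m → #bad h m * 8 ^ (2 + h) ≤ 8 * (2 ^ (2 + (h + (m + h))) * 7 ^ (2 + h))
  #bad-bound h m = begin
    #bad h m * 8 ^ H
      ≤⟨ *-monoˡ-≤ (8 ^ H) (#bad≤∑#missing h m) ⟩
    ∑[ i < L ] #missing N (suc i) * 8 ^ H
      ≡⟨ cong (_* 8 ^ H) (∑<-reverse L (λ i → #missing N (suc i))) ⟩
    ∑[ v < L ] #missing N (suc (L ∸ suc v)) * 8 ^ H
      ≡⟨ ∑<-distribʳ-* L (λ v → #missing N (suc (L ∸ suc v))) (8 ^ H) ⟨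
    ∑[ v < L ] (#missing N (suc (L ∸ suc v)) * 8 ^ H)
      ≤⟨ ∑<-geometric 7 L (λ v → #missing N (suc (L ∸ suc v)) * 8 ^ H) (2 ^ N * 7 ^ H) decay ⟩
    8 * (2 ^ N * 7 ^ H) ∎
    where
    open ≤-Reasoning
    L = h + m
    H = 2 + h
    N = 2 + (h + (m + h))
    decay : ∀ v → v < L → #missing N (suc (L ∸ suc v)) * 8 ^ H * 8 ^ v ≤ 2 ^ N * 7 ^ H * 7 ^ v
    decay v v<L = begin
      #missing N d * 8 ^ H * 8 ^ v    ≡⟨ *-assoc (#missing N d) (8 ^ H) (8 ^ v) ⟩
      #missing N d * (8 ^ H * 8 ^ v)  ≡⟨ cong (#missing N d *_) (^-distribˡ-+-* 8 H v) ⟨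
      #missing N d * 8 ^ (H + v)      ≤⟨ subst (λ n → #missing n d * 8 ^ (H + v) ≤ 2 ^ n * 7 ^ (H + v)) d+[H+v]≡N
                                               (#missing-decay d (H + v)) ⟩
      2 ^ N * 7 ^ (H + v)             ≡⟨ cong (2 ^ N *_) (^-distribˡ-+-* 7 H v) ⟩
      2 ^ N * (7 ^ H * 7 ^ v)         ≡⟨ *-assoc (2 ^ N) (7 ^ H) (7 ^ v) ⟨
      2 ^ N * 7 ^ H * 7 ^ v           ∎
      where
      d = suc (L ∸ suc v)
      d+[H+v]≡N : d + (H + v) ≡ N
      d+[H+v]≡N = begin-equality
        suc (L ∸ suc v) + (H + v)   ≡⟨ lemma (L ∸ suc v) H v ⟩
        (suc v + (L ∸ suc v)) + H   ≡⟨ cong (_+ H) (m+[n∸m]≡n v<L) ⟩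
        L + H                       ≡⟨ lemma′ h m ⟩
        N                           ∎
        where
        lemma : ∀ k H v → suc k + (H + v) ≡ (suc v + k) + H
        lemma = solve-∀
        lemma′ : ∀ h m → (h + m) + (2 + h) ≡ 2 + (h + (m + h))
        lemma′ = solve-∀

module Fractions where

  open import Data.Integer as ℤ using (ℤ; +_)
  import Data.Integer.Properties as ℤ
  open import Data.Integer.Tactic.RingSolver using (solve-∀)
  open import Data.Nat as ℕ using (ℕ; suc; NonZero; _^_)
  import Data.Nat.Properties as ℕ
  open import Data.Rational as ℚ using (ℚ; _/_; toℚᵘ; _+_; _*_; _-_; -_; ∣_∣; _≤_; _<_)
  import Data.Rational.Properties as ℚ
  open import Data.Rational.Unnormalised as ℚᵘ using (ℚᵘ; mkℚᵘ; *≡*; *≤*; *<*)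
  import Data.Rational.Unnormalised.Properties as ℚᵘ
  open import Relation.Binary.PropositionalEquality

  private
    toℚᵘ-/ : ∀ x d .{{_ : NonZero d}} → toℚᵘ (x / d) ℚᵘ.≃ mkℚᵘ x (ℕ.pred d)
    toℚᵘ-/ x (suc d) = ℚ.toℚᵘ-fromℚᵘ (mkℚᵘ x d)

  /-≡ : ∀ x y d e .{{_ : NonZero d}} .{{_ : NonZero e}} → x ℤ.* + e ≡ y ℤ.* + d → x / d ≡ y / e
  /-≡ x y d@(suc _) e@(suc _) eq =
    ℚ.toℚᵘ-injective (ℚᵘ.≃-trans (toℚᵘ-/ x d) (ℚᵘ.≃-trans (*≡* eq) (ℚᵘ.≃-sym (toℚᵘ-/ y e))))

  /-+ : ∀ x y d e .{{_ : NonZero d}} .{{_ : NonZero e}} →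
    x / d + y / e ≡ ((x ℤ.* + e ℤ.+ y ℤ.* + d) / (d ℕ.* e)) {{ℕ.m*n≢0 d e}}
  /-+ x y d@(suc _) e@(suc _) = ℚ.toℚᵘ-injective (ℚᵘ.≃-trans (ℚ.toℚᵘ-homo-+ (x / d) (y / e))
    (ℚᵘ.≃-trans (ℚᵘ.+-cong (toℚᵘ-/ x d) (toℚᵘ-/ y e)) (ℚᵘ.≃-sym (toℚᵘ-/ _ (d ℕ.* e)))))

  /-* : ∀ x y d e .{{_ : NonZero d}} .{{_ : NonZero e}} → (x / d) * (y / e) ≡ ((x ℤ.* y) / (d ℕ.* e)) {{ℕ.m*n≢0 d e}}
  /-* x y d@(suc _) e@(suc _) = ℚ.toℚᵘ-injective (ℚᵘ.≃-trans (ℚ.toℚᵘ-homo-* (x / d) (y / e))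
    (ℚᵘ.≃-trans (ℚᵘ.*-cong (toℚᵘ-/ x d) (toℚᵘ-/ y e)) (ℚᵘ.≃-sym (toℚᵘ-/ _ (d ℕ.* e)))))

  /-neg : ∀ x d .{{_ : NonZero d}} → - (x / d) ≡ (ℤ.- x) / d
  /-neg x d@(suc _) = ℚ.toℚᵘ-injective (ℚᵘ.≃-trans (ℚ.toℚᵘ-homo‿- (x / d))
    (ℚᵘ.≃-trans (ℚᵘ.-‿cong (toℚᵘ-/ x d)) (ℚᵘ.≃-sym (toℚᵘ-/ _ d))))

  /-∣∣ : ∀ x d .{{_ : NonZero d}} → ∣ x / d ∣ ≡ (+ ℤ.∣ x ∣) / d
  /-∣∣ x d@(suc _) = ℚ.toℚᵘ-injective (ℚᵘ.≃-trans (ℚ.toℚᵘ-homo-∣-∣ (x / d))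
    (ℚᵘ.≃-trans (ℚᵘ.∣-∣-cong (toℚᵘ-/ x d)) (ℚᵘ.≃-sym (toℚᵘ-/ _ d))))

  /-≤ : ∀ x y d e .{{_ : NonZero d}} .{{_ : NonZero e}} → x ℤ.* + e ℤ.≤ y ℤ.* + d → x / d ≤ y / e
  /-≤ x y d@(suc _) e@(suc _) le =
    ℚ.toℚᵘ-cancel-≤ (ℚᵘ.≤-respˡ-≃ (ℚᵘ.≃-sym (toℚᵘ-/ x d)) (ℚᵘ.≤-respʳ-≃ (ℚᵘ.≃-sym (toℚᵘ-/ y e)) (*≤* le)))

  /-< : ∀ x y d e .{{_ : NonZero d}} .{{_ : NonZero e}} → x ℤ.* + e ℤ.< y ℤ.* + d → x / d < y / e
  /-< x y d@(suc _) e@(suc _) lt =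
    ℚ.toℚᵘ-cancel-< (ℚᵘ.<-respˡ-≃ (ℚᵘ.≃-sym (toℚᵘ-/ x d)) (ℚᵘ.<-respʳ-≃ (ℚᵘ.≃-sym (toℚᵘ-/ y e)) (*<* lt)))

  /-+-same : ∀ x y d .{{_ : NonZero d}} → x / d + y / d ≡ (x ℤ.+ y) / d
  /-+-same x y d = trans (/-+ x y d d) (/-≡ (x ℤ.* + d ℤ.+ y ℤ.* + d) (x ℤ.+ y) (d ℕ.* d) d {{ℕ.m*n≢0 d d}} (begin
    (x ℤ.* + d ℤ.+ y ℤ.* + d) ℤ.* + d   ≡⟨ lemma x y (+ d) ⟩
    (x ℤ.+ y) ℤ.* (+ d ℤ.* + d)         ≡⟨ cong ((x ℤ.+ y) ℤ.*_) (ℤ.pos-* d d) ⟨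
    (x ℤ.+ y) ℤ.* + (d ℕ.* d)           ∎))
    where
    open ≡-Reasoning
    lemma : ∀ x y D → (x ℤ.* D ℤ.+ y ℤ.* D) ℤ.* D ≡ (x ℤ.+ y) ℤ.* (D ℤ.* D)
    lemma = solve-∀

  /---same : ∀ x y d .{{_ : NonZero d}} → x / d - y / d ≡ (x ℤ.- y) / d
  /---same x y d = trans (cong (_+_ (x / d)) (/-neg y d)) (/-+-same x (ℤ.- y) d)

  /-mono-≤ : ∀ {x y} d .{{_ : NonZero d}} → x ℤ.≤ y → x / d ≤ y / d
  /-mono-≤ {x} {y} d le = /-≤ x y d d (ℤ.*-monoʳ-≤-nonNeg (+ d) le)

  private
    2^≢0 : ∀ a → NonZero (2 ^ a)
    2^≢0 a = ℕ.m^n≢0 2 a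

  infixl 7 _/2^_
  _/2^_ : ℤ → ℕ → ℚ
  x /2^ a = (x / 2 ^ a) {{2^≢0 a}}

  /2^-* : ∀ x y a b → (x /2^ a) * (y /2^ b) ≡ (x ℤ.* y) /2^ (a ℕ.+ b)
  /2^-* x y a b = trans (/-* x y (2 ^ a) (2 ^ b) {{2^≢0 a}} {{2^≢0 b}})
    (/-≡ (x ℤ.* y) (x ℤ.* y) (2 ^ a ℕ.* 2 ^ b) (2 ^ (a ℕ.+ b)) {{ℕ.m*n≢0 (2 ^ a) (2 ^ b) {{2^≢0 a}} {{2^≢0 b}}}} {{2^≢0 (a ℕ.+ b)}}
         (cong (λ n → (x ℤ.* y) ℤ.* + n) (ℕ.^-distribˡ-+-* 2 a b)))

  /2^-shift : ∀ x a b → x /2^ a ≡ (x ℤ.* + (2 ^ b)) /2^ (b ℕ.+ a)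
  /2^-shift x a b = /-≡ x (x ℤ.* + (2 ^ b)) (2 ^ a) (2 ^ (b ℕ.+ a)) {{2^≢0 a}} {{2^≢0 (b ℕ.+ a)}} (begin
    x ℤ.* + (2 ^ (b ℕ.+ a))               ≡⟨ cong (λ n → x ℤ.* + n) (ℕ.^-distribˡ-+-* 2 b a) ⟩
    x ℤ.* + (2 ^ b ℕ.* 2 ^ a)             ≡⟨ cong (x ℤ.*_) (ℤ.pos-* (2 ^ b) (2 ^ a)) ⟩
    x ℤ.* (+ (2 ^ b) ℤ.* + (2 ^ a))       ≡⟨ ℤ.*-assoc x _ _ ⟨
    (x ℤ.* + (2 ^ b)) ℤ.* + (2 ^ a)       ∎)
    where open ≡-Reasoning

  /2^-+ : ∀ x y a → x /2^ a + y /2^ a ≡ (x ℤ.+ y) /2^ a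
  /2^-+ x y a = /-+-same x y (2 ^ a) {{2^≢0 a}}

  /2^-- : ∀ x y a → x /2^ a - y /2^ a ≡ (x ℤ.- y) /2^ a
  /2^-- x y a = /---same x y (2 ^ a) {{2^≢0 a}}

  /2^-∣∣ : ∀ x a → ∣ x /2^ a ∣ ≡ (+ ℤ.∣ x ∣) /2^ a
  /2^-∣∣ x a = /-∣∣ x (2 ^ a) {{2^≢0 a}}

  /2^-mono-≤ : ∀ {x y} a → x ℤ.≤ y → x /2^ a ≤ y /2^ a
  /2^-mono-≤ a = /-mono-≤ (2 ^ a) {{2^≢0 a}}

module Limits where

  open import Data.Nat as ℕ using (ℕ; zero; suc; z<s; s<s)
  import Data.Nat.Properties as ℕ
  open import Data.Product using (_,_; proj₁; proj₂; ∃-syntax)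
  open import Data.Rational as ℚ using (ℚ; 0ℚ; 1ℚ; ½; _+_; _-_; _*_; -_; ∣_∣; 1/_; _<_; _≤_; Positive; NonZero)
  import Data.Rational.Properties as ℚ
  open import Data.Rational.Solver using (module +-*-Solver)
  open import Function using (_∘_)
  open import Relation.Binary.PropositionalEquality
  open import Defs using (TendsToZero)

  open +-*-Solver

  Cauchy : (ℕ → ℚ) → Set
  Cauchy x = ∀ ε → 0ℚ < ε → ∃[ N ] (∀ m n → N ℕ.≤ m → N ℕ.≤ n → ∣ x m - x n ∣ < ε)

  private
    ε*½>0 : ∀ {ε} → 0ℚ < ε → 0ℚ < ε * ½
    ε*½>0 {ε} ε>0 = subst (_< ε * ½) (ℚ.*-zeroˡ ½) (ℚ.*-monoˡ-<-pos ½ ε>0)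

    ε*½+ε*½≡ε : ∀ ε → ε * ½ + ε * ½ ≡ ε
    ε*½+ε*½≡ε = solve 1 (λ e → e :* con ½ :+ e :* con ½ := e) refl

  TendsToZero-eventually : ∀ {a b : ℕ → ℚ} N₀ → (∀ n → N₀ ℕ.≤ n → a n ≡ b n) → TendsToZero b → TendsToZero a
  TendsToZero-eventually N₀ a≡b b→0 ε ε>0 with N , small ← b→0 ε ε>0 =
    N₀ ℕ.+ N , λ n N₀+N≤n → subst (λ z → ∣ z ∣ < ε) (sym (a≡b n (ℕ.m+n≤o⇒m≤o N₀ N₀+N≤n))) (small n (ℕ.m+n≤o⇒n≤o N₀ N₀+N≤n))

  TendsToZero-+ : ∀ {a b : ℕ → ℚ} → TendsToZero a → TendsToZero b → TendsToZero (λ n → a n + b n)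
  TendsToZero-+ {a} {b} a→0 b→0 ε ε>0
    with N₁ , a-small ← a→0 (ε * ½) (ε*½>0 ε>0) | N₂ , b-small ← b→0 (ε * ½) (ε*½>0 ε>0) =
    N₁ ℕ.+ N₂ , λ n N₁+N₂≤n → ℚ.≤-<-trans (ℚ.∣p+q∣≤∣p∣+∣q∣ (a n) (b n))
      (subst (∣ a n ∣ + ∣ b n ∣ <_) (ε*½+ε*½≡ε ε)
        (ℚ.+-mono-< (a-small n (ℕ.m+n≤o⇒m≤o N₁ N₁+N₂≤n)) (b-small n (ℕ.m+n≤o⇒n≤o N₁ N₁+N₂≤n))))

  TendsToZero-*ˡ : ∀ c {a : ℕ → ℚ} → TendsToZero a → TendsToZero (λ n → c * a n)
  TendsToZero-*ˡ c {a} a→0 ε ε>0 = proj₁ small , λ n N≤n → begin-strict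
    ∣ c * a n ∣         ≡⟨ ℚ.∣p*q∣≡∣p∣*∣q∣ c (a n) ⟩
    ∣ c ∣ * ∣ a n ∣     ≤⟨ ℚ.*-monoʳ-≤-nonNeg ∣ a n ∣ {{ℚ.∣-∣-nonNeg (a n)}} ∣c∣≤C ⟩
    C * ∣ a n ∣         <⟨ ℚ.*-monoʳ-<-pos C (proj₂ small n N≤n) ⟩
    C * (ε * 1/ C)      ≡⟨ C*[ε*1/C]≡ε ⟩
    ε                   ∎
    where
    open ℚ.≤-Reasoning
    C = ∣ c ∣ + 1ℚ
    instance
      C-pos : Positive C
      C-pos = ℚ.nonNeg+pos⇒pos ∣ c ∣ {{ℚ.∣-∣-nonNeg c}} 1ℚ
      C-nonZero : NonZero C
      C-nonZero = ℚ.pos⇒nonZero C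
    ε/C>0 : 0ℚ < ε * 1/ C
    ε/C>0 = subst (_< ε * 1/ C) (ℚ.*-zeroˡ (1/ C)) (ℚ.*-monoˡ-<-pos (1/ C) {{ℚ.1/pos⇒pos C}} ε>0)
    small = a→0 (ε * 1/ C) ε/C>0
    ∣c∣≤C : ∣ c ∣ ≤ C
    ∣c∣≤C = subst (_≤ C) (ℚ.+-identityʳ ∣ c ∣) (ℚ.+-monoʳ-≤ ∣ c ∣ (ℚ.nonNegative⁻¹ 1ℚ))
    C*[ε*1/C]≡ε : C * (ε * 1/ C) ≡ ε
    C*[ε*1/C]≡ε = begin-equality
      C * (ε * 1/ C)      ≡⟨ cong (C *_) (ℚ.*-comm ε (1/ C)) ⟩
      C * (1/ C * ε)      ≡⟨ ℚ.*-assoc C (1/ C) ε ⟨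
      (C * 1/ C) * ε      ≡⟨ cong (_* ε) (ℚ.*-inverseʳ C) ⟩
      1ℚ * ε              ≡⟨ ℚ.*-identityˡ ε ⟩
      ε                   ∎

  ∑ℚ< : ℕ → (ℕ → ℚ) → ℚ
  ∑ℚ< zero    f = 0ℚ
  ∑ℚ< (suc n) f = f 0 + ∑ℚ< n (f ∘ suc)

  syntax ∑ℚ< n (λ i → e) = ∑ℚ[ i < n ] e

  ∑ℚ<-cong : ∀ n {f g} → (∀ i → i ℕ.< n → f i ≡ g i) → ∑ℚ< n f ≡ ∑ℚ< n g
  ∑ℚ<-cong zero    eq = refl
  ∑ℚ<-cong (suc n) eq = cong₂ _+_ (eq 0 z<s) (∑ℚ<-cong n (λ i i<n → eq (suc i) (s<s i<n)))

  ∑ℚ<-distrib-- : ∀ n f g → ∑ℚ< n f - ∑ℚ< n g ≡ ∑ℚ[ i < n ] (f i - g i)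
  ∑ℚ<-distrib-- zero    f g = ℚ.+-inverseʳ 0ℚ
  ∑ℚ<-distrib-- (suc n) f g =
    trans (lemma (f 0) (g 0) (∑ℚ< n (f ∘ suc)) (∑ℚ< n (g ∘ suc))) (cong (f 0 - g 0 +_) (∑ℚ<-distrib-- n (f ∘ suc) (g ∘ suc)))
    where
    lemma : ∀ a b c d → (a + c) - (b + d) ≡ (a - b) + (c - d)
    lemma = solve 4 (λ a b c d → (a :+ c) :- (b :+ d) := (a :- b) :+ (c :- d)) refl

  TendsToZero-∑ : ∀ n (f : ℕ → ℕ → ℚ) → (∀ i → i ℕ.< n → TendsToZero (f i)) → TendsToZero (λ m → ∑ℚ[ i < n ] f i m)
  TendsToZero-∑ zero    f f→0 ε ε>0 = 0 , λ _ _ → ε>0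
  TendsToZero-∑ (suc n) f f→0 = TendsToZero-+ (f→0 0 z<s) (TendsToZero-∑ n (f ∘ suc) (λ i i<n → f→0 (suc i) (s<s i<n)))

  TendsToInfinity : (ℕ → ℕ) → Set
  TendsToInfinity f = ∀ N → ∃[ M ] (∀ m → M ℕ.≤ m → N ℕ.≤ f m)

  ∸-tendsToInfinity : ∀ a → TendsToInfinity (ℕ._∸ a)
  ∸-tendsToInfinity a N = N ℕ.+ a , λ m N+a≤m → ℕ.m+n≤o⇒m≤o∸n N N+a≤m

  Cauchy⇒TendsToZero : ∀ {x f g} → Cauchy x → TendsToInfinity f → TendsToInfinity g → TendsToZero (λ m → x (f m) - x (g m))
  Cauchy⇒TendsToZero x-Cauchy f→∞ g→∞ ε ε>0
    with N , close ← x-Cauchy ε ε>0 with M₁ , f-large ← f→∞ N | M₂ , g-large ← g→∞ N =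
    M₁ ℕ.+ M₂ , λ m M₁+M₂≤m → close _ _ (f-large m (ℕ.m+n≤o⇒m≤o M₁ M₁+M₂≤m)) (g-large m (ℕ.m+n≤o⇒n≤o M₁ M₁+M₂≤m))

  eventually-near⇒Cauchy : ∀ {x : ℕ → ℚ} →
    (∀ δ → 0ℚ < δ → ∃[ N ] ∃[ y ] (∀ m → N ℕ.≤ m → ∣ x m - y ∣ < δ)) → Cauchy x
  eventually-near⇒Cauchy {x} near ε ε>0 with N , y , close ← near (ε * ½) (ε*½>0 ε>0) = N , λ m n N≤m N≤n → begin-strict
    ∣ x m - x n ∣                   ≡⟨ cong ∣_∣ (lemma (x m) (x n) y) ⟩
    ∣ (x m - y) - (x n - y) ∣       ≤⟨ ℚ.∣p-q∣≤∣p∣+∣q∣ (x m - y) (x n - y) ⟩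
    ∣ x m - y ∣ + ∣ x n - y ∣       <⟨ ℚ.+-mono-< (close m N≤m) (close n N≤n) ⟩
    ε * ½ + ε * ½                   ≡⟨ ε*½+ε*½≡ε ε ⟩
    ε                               ∎
    where
    open ℚ.≤-Reasoning
    lemma : ∀ a b c → a - b ≡ (a - c) - (b - c)
    lemma = solve 3 (λ a b c → a :- b := (a :- c) :- (b :- c)) refl

module Identities where

  open import Data.Integer as ℤ using (ℤ; +_)
  import Data.Integer.Properties as ℤ
  open import Data.Nat as ℕ using (ℕ; zero; suc; s≤s; _∸_)
  import Data.Nat.Properties as ℕ
  open import Data.Rational as ℚ using (ℚ; _/_; _+_; _-_; _*_)
  import Data.Rational.Properties as ℚ
  open import Function using (_∘_)
  open import Relation.Binary.PropositionalEquality
  open import Defs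
  open Sums using (∑<)
  open Recurrences
  open Fractions
  open Limits

  ℓₙ≡ℓ#/2^ : ∀ n t → ℓₙ n t ≡ + ℓ# n t /2^ n
  ℓₙ≡ℓ#/2^ n t = cong (λ c → + c /2^ n) (countStat≡ℓ# n t)

  jₙ₊₂≡j#/2^ : ∀ m t → jₙ₊₂ m t ≡ + j# m t /2^ m
  jₙ₊₂≡j#/2^ m t = cong (λ c → + c /2^ m) (#endpointsIn≡j# m t)

  ∑ℚ-/2^ : ∀ n (x : ℕ → ℕ) a → ∑ℚ[ i < n ] (+ x i /2^ a) ≡ + ∑< n x /2^ a
  ∑ℚ-/2^ zero    x a = sym (ℚ.0/n≡0 (2 ℕ.^ a) {{ℕ.m^n≢0 2 a}})
  ∑ℚ-/2^ (suc n) x a = begin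
    + x 0 /2^ a + ∑ℚ[ i < n ] (+ x (suc i) /2^ a)    ≡⟨ cong (_+_ (+ x 0 /2^ a)) (∑ℚ-/2^ n (x ∘ suc) a) ⟩
    + x 0 /2^ a + + ∑< n (x ∘ suc) /2^ a            ≡⟨ /2^-+ (+ x 0) (+ ∑< n (x ∘ suc)) a ⟩
    (+ x 0 ℤ.+ + ∑< n (x ∘ suc)) /2^ a              ≡⟨ cong (_/2^ a) (ℤ.pos-+ (x 0) (∑< n (x ∘ suc))) ⟨
    + ∑< (suc n) x /2^ a                            ∎
    where open ≡-Reasoning

  ℓₙ≡∑weight*jₙ₊₂ : ∀ K M t → K ℕ.≤ M → t ℤ.≤ + K →
    ℓₙ (2 ℕ.+ M) t ≡ ∑ℚ[ s < suc K ] (weight s * jₙ₊₂ (M ∸ s) (t ℤ.- + (2 ℕ.* s)))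
  ℓₙ≡∑weight*jₙ₊₂ K M t K≤M t≤K = begin
    ℓₙ (2 ℕ.+ M) t
      ≡⟨ ℓₙ≡ℓ#/2^ (2 ℕ.+ M) t ⟩
    + ℓ# (2 ℕ.+ M) t /2^ (2 ℕ.+ M)
      ≡⟨ cong (λ c → + c /2^ (2 ℕ.+ M)) (ℓ#-unfold K M t K≤M t≤K) ⟩
    + ∑< (suc K) c /2^ (2 ℕ.+ M)
      ≡⟨ ∑ℚ-/2^ (suc K) c (2 ℕ.+ M) ⟨
    ∑ℚ[ s < suc K ] (+ c s /2^ (2 ℕ.+ M))
      ≡⟨ ∑ℚ<-cong (suc K) term ⟩
    ∑ℚ[ s < suc K ] (weight s * jₙ₊₂ (M ∸ s) (t ℤ.- + (2 ℕ.* s))) ∎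
    where
    open ≡-Reasoning
    c : ℕ → ℕ
    c s = suc s ℕ.* j# (M ∸ s) (t ℤ.- + (2 ℕ.* s))
    term : ∀ s → s ℕ.< suc K → + c s /2^ (2 ℕ.+ M) ≡ weight s * jₙ₊₂ (M ∸ s) (t ℤ.- + (2 ℕ.* s))
    term s (s≤s s≤K) = begin
      + c s /2^ (2 ℕ.+ M)
        ≡⟨ cong₂ _/2^_ (ℤ.pos-* (suc s) jₛ) (cong (2 ℕ.+_) (sym (ℕ.m+[n∸m]≡n (ℕ.≤-trans s≤K K≤M)))) ⟩
      (+ suc s ℤ.* + jₛ) /2^ (2 ℕ.+ s ℕ.+ (M ∸ s))
        ≡⟨ /2^-* (+ suc s) (+ jₛ) (2 ℕ.+ s) (M ∸ s) ⟨
      weight s * (+ jₛ /2^ (M ∸ s))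
        ≡⟨ cong (weight s *_) (jₙ₊₂≡j#/2^ (M ∸ s) (t ℤ.- + (2 ℕ.* s))) ⟨
      weight s * jₙ₊₂ (M ∸ s) (t ℤ.- + (2 ℕ.* s)) ∎
      where
      jₛ = j# (M ∸ s) (t ℤ.- + (2 ℕ.* s))

  2^b*[x/2^[b+a]]≡x/2^a : ∀ x a b → (+ (2 ℕ.^ b) / 1) * (x /2^ (b ℕ.+ a)) ≡ x /2^ a
  2^b*[x/2^[b+a]]≡x/2^a x a b = begin
    (+ (2 ℕ.^ b) /2^ 0) * (x /2^ (b ℕ.+ a))   ≡⟨ /2^-* (+ (2 ℕ.^ b)) x 0 (b ℕ.+ a) ⟩
    (+ (2 ℕ.^ b) ℤ.* x) /2^ (b ℕ.+ a)         ≡⟨ cong (_/2^ (b ℕ.+ a)) (ℤ.*-comm (+ (2 ℕ.^ b)) x) ⟩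
    (x ℤ.* + (2 ℕ.^ b)) /2^ (b ℕ.+ a)         ≡⟨ /2^-shift x a b ⟨
    x /2^ a                                   ∎
    where open ≡-Reasoning

  four : ℚ
  four = + 4 / 1

  jₙ₊₂≡Δ²ℓₙ : ∀ m t →
    jₙ₊₂ m t ≡ (four * ℓₙ (2 ℕ.+ m) t - four * ℓₙ (1 ℕ.+ m) (t ℤ.- + 2)) + ℓₙ m ((t ℤ.- + 2) ℤ.- + 2)
  jₙ₊₂≡Δ²ℓₙ m t = begin
    jₙ₊₂ m t
      ≡⟨ jₙ₊₂≡j#/2^ m t ⟩
    + j# m t /2^ m
      ≡⟨ cong (_/2^ m) (j#≡Δ²ℓ# m t) ⟩
    ((+ ℓ₂ ℤ.- + 2 ℤ.* + ℓ₁) ℤ.+ + ℓ₀) /2^ m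
      ≡⟨ /2^-+ (+ ℓ₂ ℤ.- + 2 ℤ.* + ℓ₁) (+ ℓ₀) m ⟨
    (+ ℓ₂ ℤ.- + 2 ℤ.* + ℓ₁) /2^ m + + ℓ₀ /2^ m
      ≡⟨ cong (_+ + ℓ₀ /2^ m) (/2^-- (+ ℓ₂) (+ 2 ℤ.* + ℓ₁) m) ⟨
    (+ ℓ₂ /2^ m - (+ 2 ℤ.* + ℓ₁) /2^ m) + + ℓ₀ /2^ m
      ≡⟨ cong₂ (λ x y → (x - y) + + ℓ₀ /2^ m) (2^b*[x/2^[b+a]]≡x/2^a (+ ℓ₂) m 2) (trans (cong (four *_) ℓ₁/2^[1+m]≡) (2^b*[x/2^[b+a]]≡x/2^a (+ 2 ℤ.* + ℓ₁) m 2)) ⟨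
    (four * (+ ℓ₂ /2^ (2 ℕ.+ m)) - four * (+ ℓ₁ /2^ (1 ℕ.+ m))) + + ℓ₀ /2^ m
      ≡⟨ cong₂ (λ x y → (four * x - four * y) + + ℓ₀ /2^ m) (ℓₙ≡ℓ#/2^ (2 ℕ.+ m) t) (ℓₙ≡ℓ#/2^ (1 ℕ.+ m) (t ℤ.- + 2)) ⟨
    (four * ℓₙ (2 ℕ.+ m) t - four * ℓₙ (1 ℕ.+ m) (t ℤ.- + 2)) + + ℓ₀ /2^ m
      ≡⟨ cong (_+_ (four * ℓₙ (2 ℕ.+ m) t - four * ℓₙ (1 ℕ.+ m) (t ℤ.- + 2))) (ℓₙ≡ℓ#/2^ m _) ⟨
    (four * ℓₙ (2 ℕ.+ m) t - four * ℓₙ (1 ℕ.+ m) (t ℤ.- + 2)) + ℓₙ m ((t ℤ.- + 2) ℤ.- + 2) ∎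
    where
    open ≡-Reasoning
    ℓ₂ = ℓ# (2 ℕ.+ m) t
    ℓ₁ = ℓ# (1 ℕ.+ m) (t ℤ.- + 2)
    ℓ₀ = ℓ# m ((t ℤ.- + 2) ℤ.- + 2)
    ℓ₁/2^[1+m]≡ : + ℓ₁ /2^ (1 ℕ.+ m) ≡ (+ 2 ℤ.* + ℓ₁) /2^ (2 ℕ.+ m)
    ℓ₁/2^[1+m]≡ = trans (/2^-shift (+ ℓ₁) (1 ℕ.+ m) 1) (cong (_/2^ (2 ℕ.+ m)) (ℤ.*-comm (+ ℓ₁) (+ 2)))

module Convergence where

  open import Data.Integer as ℤ using (ℤ; +_)
  import Data.Integer.Properties as ℤ
  open import Data.Nat as ℕ using (ℕ; zero; suc; _^_)
  import Data.Nat.Properties as ℕ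
  open import Data.Nat.Tactic.RingSolver using (solve-∀)
  open import Data.Product using (_,_; proj₁; proj₂; ∃-syntax)
  open import Data.Rational as ℚ using (ℚ; _/_; 0ℚ; _-_; _*_; ∣_∣; _≤_; _<_)
  import Data.Rational.Properties as ℚ
  open import Relation.Binary.PropositionalEquality
  open import Relation.Nullary using (yes; no)
  open import Defs
  open Recurrences
  open Stabilisation
  open Fractions
  open Limits
  open Identities

  ∣+a-+b∣≤ : ∀ {a b c} → a ℕ.≤ b ℕ.+ c → b ℕ.≤ a ℕ.+ c → ℤ.∣ + a ℤ.- + b ∣ ℕ.≤ c
  ∣+a-+b∣≤ {a} {b} {c} a≤b+c b≤a+c with a ℕ.≤? b
  ... | yes a≤b = ℕ.≤-trans (ℕ.≤-reflexive (trans (cong ℤ.∣_∣ (ℤ.m-n≡m⊖n a b)) (ℤ.∣⊖∣-≤ a≤b)))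
                            (ℕ.m≤n+o⇒m∸n≤o b a b≤a+c)
  ... | no a≰b  = ℕ.≤-trans (ℕ.≤-reflexive (trans (cong ℤ.∣_∣ (ℤ.m-n≡m⊖n a b)) (trans (ℤ.∣m⊖n∣≡∣n⊖m∣ a b) (ℤ.∣⊖∣-≤ (ℕ.<⇒≤ (ℕ.≰⇒> a≰b))))))
                            (ℕ.m≤n+o⇒m∸n≤o a b a≤b+c)

  E : ℕ → ℚ
  E h = (+ (32 ℕ.* 7 ^ (2 ℕ.+ h)) / 8 ^ (2 ℕ.+ h)) {{ℕ.m^n≢0 8 (2 ℕ.+ h)}}

  jₙ₊₂-approx : ∀ h m t → ∣ jₙ₊₂ (h ℕ.+ (m ℕ.+ h)) t - + G# h t /2^ (h ℕ.+ h) ∣ ≤ E h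
  jₙ₊₂-approx h m t = begin
    ∣ jₙ₊₂ M t - + G# h t /2^ (h ℕ.+ h) ∣
      ≡⟨ cong₂ (λ x y → ∣ x - y ∣) (jₙ₊₂≡j#/2^ M t) G#/2^≡ ⟩
    ∣ + j# M t /2^ M - + (2 ^ m ℕ.* G# h t) /2^ M ∣
      ≡⟨ cong ∣_∣ (/2^-- (+ j# M t) (+ (2 ^ m ℕ.* G# h t)) M) ⟩
    ∣ (+ j# M t ℤ.- + (2 ^ m ℕ.* G# h t)) /2^ M ∣
      ≡⟨ /2^-∣∣ (+ j# M t ℤ.- + (2 ^ m ℕ.* G# h t)) M ⟩
    + ℤ.∣ + j# M t ℤ.- + (2 ^ m ℕ.* G# h t) ∣ /2^ M
      ≤⟨ /2^-mono-≤ M (ℤ.+≤+ (∣+a-+b∣≤ (j#≤2^m*G#+#bad h m t) (2^m*G#≤j#+#bad h m t))) ⟩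
    + #bad h m /2^ M
      ≤⟨ /-≤ (+ #bad h m) (+ (32 ℕ.* 7 ^ H)) (2 ^ M) (8 ^ H) {{ℕ.m^n≢0 2 M}} {{ℕ.m^n≢0 8 H}}
             (subst₂ ℤ._≤_ (ℤ.pos-* (#bad h m) (8 ^ H)) (ℤ.pos-* (32 ℕ.* 7 ^ H) (2 ^ M)) (ℤ.+≤+ #bad*8^H≤)) ⟩
    E h ∎
    where
    open ℚ.≤-Reasoning
    M = h ℕ.+ (m ℕ.+ h)
    H = 2 ℕ.+ h
    G#/2^≡ : + G# h t /2^ (h ℕ.+ h) ≡ + (2 ^ m ℕ.* G# h t) /2^ M
    G#/2^≡ = trans (/2^-shift (+ G# h t) (h ℕ.+ h) m)
                   (cong₂ _/2^_ (trans (sym (ℤ.pos-* (G# h t) (2 ^ m))) (cong +_ (ℕ.*-comm (G# h t) (2 ^ m))))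
                                (m+[h+h]≡h+[m+h] m h))
      where
      m+[h+h]≡h+[m+h] : ∀ m h → m ℕ.+ (h ℕ.+ h) ≡ h ℕ.+ (m ℕ.+ h)
      m+[h+h]≡h+[m+h] = solve-∀
    #bad*8^H≤ : #bad h m ℕ.* 8 ^ H ℕ.≤ 32 ℕ.* 7 ^ H ℕ.* 2 ^ M
    #bad*8^H≤ = ℕ.≤-trans (#bad-bound h m) (ℕ.≤-reflexive (lemma (2 ^ M) (7 ^ H)))
      where
      lemma : ∀ x y → 8 ℕ.* (2 ℕ.* (2 ℕ.* x) ℕ.* y) ≡ 32 ℕ.* y ℕ.* x
      lemma = solve-∀

  7^n*[7+n]≤7*8^n : ∀ n → 7 ^ n ℕ.* (7 ℕ.+ n) ℕ.≤ 7 ℕ.* 8 ^ n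
  7^n*[7+n]≤7*8^n zero    = ℕ.≤-refl
  7^n*[7+n]≤7*8^n (suc n) = begin
    7 ℕ.* 7 ^ n ℕ.* (7 ℕ.+ suc n)                  ≡⟨ lemma₁ (7 ^ n) n ⟩
    7 ℕ.* (7 ^ n ℕ.* (7 ℕ.+ n)) ℕ.+ 7 ℕ.* 7 ^ n    ≤⟨ ℕ.+-mono-≤ (ℕ.*-monoʳ-≤ 7 (7^n*[7+n]≤7*8^n n))
                                                                 (ℕ.*-monoʳ-≤ 7 (ℕ.^-monoˡ-≤ n (ℕ.n≤1+n 7))) ⟩
    7 ℕ.* (7 ℕ.* 8 ^ n) ℕ.+ 7 ℕ.* 8 ^ n            ≡⟨ lemma₂ (8 ^ n) ⟩
    7 ℕ.* (8 ℕ.* 8 ^ n)                            ∎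
    where
    open ℕ.≤-Reasoning
    lemma₁ : ∀ x n → 7 ℕ.* x ℕ.* (7 ℕ.+ suc n) ≡ 7 ℕ.* (x ℕ.* (7 ℕ.+ n)) ℕ.+ 7 ℕ.* x
    lemma₁ = solve-∀
    lemma₂ : ∀ y → 7 ℕ.* (7 ℕ.* y) ℕ.+ 7 ℕ.* y ≡ 7 ℕ.* (8 ℕ.* y)
    lemma₂ = solve-∀

  -- (7/8)^H ≤ 7/(7 + H) and 7 + H > 224 q
  32q*7^H<8^H : ∀ q → 32 ℕ.* q ℕ.* 7 ^ (2 ℕ.+ 224 ℕ.* q) ℕ.< 8 ^ (2 ℕ.+ 224 ℕ.* q)
  32q*7^H<8^H q = ℕ.*-cancelʳ-< (7 ℕ.+ H) _ _ (begin-strict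
    32 ℕ.* q ℕ.* 7 ^ H ℕ.* (7 ℕ.+ H)       ≡⟨ ℕ.*-assoc (32 ℕ.* q) (7 ^ H) (7 ℕ.+ H) ⟩
    32 ℕ.* q ℕ.* (7 ^ H ℕ.* (7 ℕ.+ H))     ≤⟨ ℕ.*-monoʳ-≤ (32 ℕ.* q) (7^n*[7+n]≤7*8^n H) ⟩
    32 ℕ.* q ℕ.* (7 ℕ.* 8 ^ H)             ≡⟨ lemma q (8 ^ H) ⟩
    224 ℕ.* q ℕ.* 8 ^ H                    <⟨ ℕ.*-monoˡ-< (8 ^ H) {{ℕ.m^n≢0 8 H}} (ℕ.m<n+m (224 ℕ.* q) {9} ℕ.z<s) ⟩
    (7 ℕ.+ H) ℕ.* 8 ^ H                    ≡⟨ ℕ.*-comm (7 ℕ.+ H) (8 ^ H) ⟩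
    8 ^ H ℕ.* (7 ℕ.+ H)                    ∎)
    where
    open ℕ.≤-Reasoning
    H = 2 ℕ.+ 224 ℕ.* q
    lemma : ∀ q y → 32 ℕ.* q ℕ.* (7 ℕ.* y) ≡ 224 ℕ.* q ℕ.* y
    lemma = solve-∀

  ↥-pos : ∀ {δ} → 0ℚ < δ → ∃[ n ] ℚ.↥ δ ≡ + suc n
  ↥-pos {δ} δ>0 with ℚ.↥ δ | ℚ.drop-*<* δ>0
  ... | + suc n | _           = n , refl
  ... | + zero  | ℤ.+<+ ()

  E-small : ∀ δ → 0ℚ < δ → ∃[ h ] E h < δ
  E-small δ δ>0 = h , subst (E h <_) (ℚ.↥p/↧p≡p δ) (/-< (+ C) (ℚ.↥ δ) (8 ^ H) (ℚ.↧ₙ δ) {{ℕ.m^n≢0 8 H}} cross)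
    where
    q = ℚ.↧ₙ δ
    h = 224 ℕ.* q
    H = 2 ℕ.+ h
    C = 32 ℕ.* 7 ^ H
    n = proj₁ (↥-pos δ>0)
    C*q<[1+n]*8^H : C ℕ.* q ℕ.< suc n ℕ.* 8 ^ H
    C*q<[1+n]*8^H = begin-strict
      32 ℕ.* 7 ^ H ℕ.* q      ≡⟨ lemma q (7 ^ H) ⟩
      32 ℕ.* q ℕ.* 7 ^ H      <⟨ 32q*7^H<8^H q ⟩
      8 ^ H                   ≤⟨ ℕ.m≤n*m (8 ^ H) (suc n) ⟩
      suc n ℕ.* 8 ^ H         ∎
      where
      open ℕ.≤-Reasoning
      lemma : ∀ q x → 32 ℕ.* x ℕ.* q ≡ 32 ℕ.* q ℕ.* x
      lemma = solve-∀
    cross : + C ℤ.* + q ℤ.< ℚ.↥ δ ℤ.* + 8 ^ H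
    cross = subst₂ ℤ._<_ (ℤ.pos-* C q) (trans (ℤ.pos-* (suc n) (8 ^ H)) (cong (ℤ._* + 8 ^ H) (sym (proj₂ (↥-pos δ>0)))))
                   (ℤ.+<+ C*q<[1+n]*8^H)

  jₙ₊₂-near : ∀ h t m → h ℕ.+ h ℕ.≤ m → ∣ jₙ₊₂ m t - + G# h t /2^ (h ℕ.+ h) ∣ ≤ E h
  jₙ₊₂-near h t m 2h≤m =
    subst (λ m → ∣ jₙ₊₂ m t - + G# h t /2^ (h ℕ.+ h) ∣ ≤ E h) h+[[m∸2h]+h]≡m (jₙ₊₂-approx h (m ℕ.∸ (h ℕ.+ h)) t)
    where
    h+[[m∸2h]+h]≡m : h ℕ.+ ((m ℕ.∸ (h ℕ.+ h)) ℕ.+ h) ≡ m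
    h+[[m∸2h]+h]≡m = trans (lemma h (m ℕ.∸ (h ℕ.+ h))) (ℕ.m+[n∸m]≡n 2h≤m)
      where
      lemma : ∀ h x → h ℕ.+ (x ℕ.+ h) ≡ (h ℕ.+ h) ℕ.+ x
      lemma = solve-∀

  jₙ₊₂-Cauchy : ∀ t → Cauchy (λ m → jₙ₊₂ m t)
  jₙ₊₂-Cauchy t = eventually-near⇒Cauchy {λ m → jₙ₊₂ m t} near
    where
    near : ∀ δ → 0ℚ < δ → ∃[ N ] ∃[ y ] (∀ m → N ℕ.≤ m → ∣ jₙ₊₂ m t - y ∣ < δ)
    near δ δ>0 = h ℕ.+ h , + G# h t /2^ (h ℕ.+ h) , λ m 2h≤m → ℚ.≤-<-trans (jₙ₊₂-near h t m 2h≤m) Eh<δ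
      where
      h = proj₁ (E-small δ δ>0)
      Eh<δ = proj₂ (E-small δ δ>0)

module Corollary where

  open import Data.Integer as ℤ using (ℤ; +_; -[1+_])
  import Data.Integer.Properties as ℤ
  import Data.Integer.Tactic.RingSolver as ℤ-Solver
  open import Data.Nat as ℕ using (ℕ; zero; suc; _∸_)
  import Data.Nat.Properties as ℕ
  open import Data.Rational as ℚ using (ℚ; _+_; _-_; _*_; -_)
  import Data.Rational.Properties as ℚ
  open import Data.Rational.Solver using (module +-*-Solver)
  open import Data.List using (applyUpTo; foldr)
  open import Function using (_∘_; id)
  open import Relation.Binary.PropositionalEquality
  open import Defs
  open Limits
  open Convergence
  open Identities

  Σ≤≡∑ℚ< : ∀ k f → Σ≤ k f ≡ ∑ℚ< (suc k) f
  Σ≤≡∑ℚ< k f = foldr-applyUpTo id (suc k)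
    where
    foldr-applyUpTo : ∀ g n → foldr (λ i acc → f i + acc) ℚ.0ℚ (applyUpTo g n) ≡ ∑ℚ< n (f ∘ g)
    foldr-applyUpTo g zero    = refl
    foldr-applyUpTo g (suc n) = cong (_+_ (f (g 0))) (foldr-applyUpTo (g ∘ suc) n)

  *-distribˡ-- : ∀ p q r → p * (q - r) ≡ p * q - p * r
  *-distribˡ-- p q r = trans (ℚ.*-distribˡ-+ p q (- r)) (cong (_+_ (p * q)) (sym (ℚ.neg-distribʳ-* p r)))

  t≤+∣t∣ : ∀ t → t ℤ.≤ + ℤ.∣ t ∣
  t≤+∣t∣ (+ n)    = ℤ.≤-refl
  t≤+∣t∣ -[1+ n ] = ℤ.-≤+

  weighted-lag-differences→0 : ∀ K t (a b : ℕ → ℕ) →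
    TendsToZero (λ m → ∑ℚ[ s < K ] (weight s * (jₙ₊₂ (m ∸ a s) (t ℤ.- + (2 ℕ.* s)) - jₙ₊₂ (m ∸ b s) (t ℤ.- + (2 ℕ.* s)))))
  weighted-lag-differences→0 K t a b = TendsToZero-∑ K _ (λ s _ → TendsToZero-*ˡ (weight s)
    (Cauchy⇒TendsToZero {λ m → jₙ₊₂ m (t ℤ.- + (2 ℕ.* s))} (jₙ₊₂-Cauchy _) (∸-tendsToInfinity (a s)) (∸-tendsToInfinity (b s))))

  ℓₙ-lag-difference→0 : ∀ t a b → TendsToZero (λ m → ℓₙ (2 ℕ.+ (m ∸ a)) t - ℓₙ (2 ℕ.+ (m ∸ b)) t)
  ℓₙ-lag-difference→0 t a b = TendsToZero-eventually (K ℕ.+ (a ℕ.+ b)) eq (weighted-lag-differences→0 (suc K) t (a ℕ.+_) (b ℕ.+_))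
    where
    K = ℤ.∣ t ∣
    w : ℕ → ℕ → ℚ
    w c s = weight s * jₙ₊₂ (c ∸ s) (t ℤ.- + (2 ℕ.* s))
    eq : ∀ m → K ℕ.+ (a ℕ.+ b) ℕ.≤ m → ℓₙ (2 ℕ.+ (m ∸ a)) t - ℓₙ (2 ℕ.+ (m ∸ b)) t
       ≡ ∑ℚ[ s < suc K ] (weight s * (jₙ₊₂ (m ∸ (a ℕ.+ s)) (t ℤ.- + (2 ℕ.* s)) - jₙ₊₂ (m ∸ (b ℕ.+ s)) (t ℤ.- + (2 ℕ.* s))))
    eq m K+[a+b]≤m = begin
      ℓₙ (2 ℕ.+ (m ∸ a)) t - ℓₙ (2 ℕ.+ (m ∸ b)) t
        ≡⟨ cong₂ _-_ (ℓₙ≡∑weight*jₙ₊₂ K (m ∸ a) t K≤m∸a (t≤+∣t∣ t)) (ℓₙ≡∑weight*jₙ₊₂ K (m ∸ b) t K≤m∸b (t≤+∣t∣ t)) ⟩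
      ∑ℚ< (suc K) (w (m ∸ a)) - ∑ℚ< (suc K) (w (m ∸ b))
        ≡⟨ ∑ℚ<-distrib-- (suc K) (w (m ∸ a)) (w (m ∸ b)) ⟩
      ∑ℚ[ s < suc K ] (w (m ∸ a) s - w (m ∸ b) s)
        ≡⟨ ∑ℚ<-cong (suc K) (λ s _ → trans (sym (*-distribˡ-- (weight s) (jₙ₊₂ (m ∸ a ∸ s) (t ℤ.- + (2 ℕ.* s))) (jₙ₊₂ (m ∸ b ∸ s) (t ℤ.- + (2 ℕ.* s)))))
             (cong₂ (λ x y → weight s * (jₙ₊₂ x (t ℤ.- + (2 ℕ.* s)) - jₙ₊₂ y (t ℤ.- + (2 ℕ.* s)))) (ℕ.∸-+-assoc m a s) (ℕ.∸-+-assoc m b s))) ⟩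
      ∑ℚ[ s < suc K ] (weight s * (jₙ₊₂ (m ∸ (a ℕ.+ s)) (t ℤ.- + (2 ℕ.* s)) - jₙ₊₂ (m ∸ (b ℕ.+ s)) (t ℤ.- + (2 ℕ.* s)))) ∎
      where
      open ≡-Reasoning
      K≤m∸a : K ℕ.≤ m ∸ a
      K≤m∸a = ℕ.m+n≤o⇒m≤o∸n K (ℕ.≤-trans (ℕ.+-monoʳ-≤ K (ℕ.m≤m+n a b)) K+[a+b]≤m)
      K≤m∸b : K ℕ.≤ m ∸ b
      K≤m∸b = ℕ.m+n≤o⇒m≤o∸n K (ℕ.≤-trans (ℕ.+-monoʳ-≤ K (ℕ.m≤n+m b a)) K+[a+b]≤m)

  ℓₙ-weighted-sum→0 : ∀ k → TendsToZero (λ m → ℓₙ (2 ℕ.+ m) (+ k) - Σ≤ k (λ i → weight i * jₙ₊₂ m (+ k ℤ.- + (2 ℕ.* i))))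
  ℓₙ-weighted-sum→0 k = TendsToZero-eventually k eq (weighted-lag-differences→0 (suc k) (+ k) id (λ _ → 0))
    where
    w : ℕ → ℕ → ℚ
    w c s = weight s * jₙ₊₂ c (+ k ℤ.- + (2 ℕ.* s))
    eq : ∀ m → k ℕ.≤ m → ℓₙ (2 ℕ.+ m) (+ k) - Σ≤ k (w m)
       ≡ ∑ℚ[ s < suc k ] (weight s * (jₙ₊₂ (m ∸ s) (+ k ℤ.- + (2 ℕ.* s)) - jₙ₊₂ (m ∸ 0) (+ k ℤ.- + (2 ℕ.* s))))
    eq m k≤m = begin
      ℓₙ (2 ℕ.+ m) (+ k) - Σ≤ k (w m)
        ≡⟨ cong₂ _-_ (ℓₙ≡∑weight*jₙ₊₂ k m (+ k) k≤m ℤ.≤-refl) (Σ≤≡∑ℚ< k (w m)) ⟩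
      ∑ℚ[ s < suc k ] w (m ∸ s) s - ∑ℚ< (suc k) (w m)
        ≡⟨ ∑ℚ<-distrib-- (suc k) (λ s → w (m ∸ s) s) (w m) ⟩
      ∑ℚ[ s < suc k ] (w (m ∸ s) s - w m s)
        ≡⟨ ∑ℚ<-cong (suc k) (λ s _ → sym (*-distribˡ-- (weight s) (jₙ₊₂ (m ∸ s) (+ k ℤ.- + (2 ℕ.* s))) (jₙ₊₂ m (+ k ℤ.- + (2 ℕ.* s))))) ⟩
      ∑ℚ[ s < suc k ] (weight s * (jₙ₊₂ (m ∸ s) (+ k ℤ.- + (2 ℕ.* s)) - jₙ₊₂ m (+ k ℤ.- + (2 ℕ.* s)))) ∎
      where open ≡-Reasoning

  jₙ₊₂-Δ²ℓₙ→0 : ∀ k → TendsToZero (λ m → jₙ₊₂ m (+ k)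
                        - ((four * ℓₙ (2 ℕ.+ m) (+ k) - four * ℓₙ (2 ℕ.+ m) (+ k ℤ.- + 2)) + ℓₙ (2 ℕ.+ m) (+ k ℤ.- + 4)))
  jₙ₊₂-Δ²ℓₙ→0 k = TendsToZero-eventually 2 eq
    (TendsToZero-+ (TendsToZero-*ˡ four (ℓₙ-lag-difference→0 (+ k ℤ.- + 2) 0 1)) (ℓₙ-lag-difference→0 (+ k ℤ.- + 4) 2 0))
    where
    k-2-2≡k-4 : ∀ t → (t ℤ.- + 2) ℤ.- + 2 ≡ t ℤ.- + 4
    k-2-2≡k-4 = ℤ-Solver.solve-∀
    lemma : ∀ a b b′ c c′ → ((four * a - four * b′) + c′) - ((four * a - four * b) + c) ≡ four * (b - b′) + (c′ - c)
    lemma = +-*-Solver.solve 5 (λ a b b′ c c′ → ((con four :* a :- con four :* b′) :+ c′) :- ((con four :* a :- con four :* b) :+ c)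
                                             := con four :* (b :- b′) :+ (c′ :- c)) refl
      where open +-*-Solver
    eq : ∀ m → 2 ℕ.≤ m →
      jₙ₊₂ m (+ k) - ((four * ℓₙ (2 ℕ.+ m) (+ k) - four * ℓₙ (2 ℕ.+ m) (+ k ℤ.- + 2)) + ℓₙ (2 ℕ.+ m) (+ k ℤ.- + 4))
      ≡ four * (ℓₙ (2 ℕ.+ (m ∸ 0)) (+ k ℤ.- + 2) - ℓₙ (2 ℕ.+ (m ∸ 1)) (+ k ℤ.- + 2))
        + (ℓₙ (2 ℕ.+ (m ∸ 2)) (+ k ℤ.- + 4) - ℓₙ (2 ℕ.+ (m ∸ 0)) (+ k ℤ.- + 4))
    eq (suc zero) (ℕ.s≤s ())
    eq (suc (suc m)) _ = trans (cong (_- ((four * ℓₙ (4 ℕ.+ m) (+ k) - four * ℓₙ (4 ℕ.+ m) (+ k ℤ.- + 2)) + ℓₙ (4 ℕ.+ m) (+ k ℤ.- + 4)))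
                                     (trans (jₙ₊₂≡Δ²ℓₙ (2 ℕ.+ m) (+ k))
                                            (cong (λ t → (four * ℓₙ (4 ℕ.+ m) (+ k) - four * ℓₙ (3 ℕ.+ m) (+ k ℤ.- + 2)) + ℓₙ (2 ℕ.+ m) t)
                                                  (k-2-2≡k-4 (+ k)))))
                               (lemma (ℓₙ (4 ℕ.+ m) (+ k)) (ℓₙ (4 ℕ.+ m) (+ k ℤ.- + 2)) (ℓₙ (3 ℕ.+ m) (+ k ℤ.- + 2))
                                      (ℓₙ (4 ℕ.+ m) (+ k ℤ.- + 4)) (ℓₙ (2 ℕ.+ m) (+ k ℤ.- + 4)))

open import Defs
open import Data.Nat using (ℕ)
import Data.Nat
open import Data.Integer using (ℤ; +_)
open import Data.Integer as ℤ using ()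
import Data.Rational
open import Data.Rational using (ℚ; _+_; _-_; _*_)
open import Data.Product using (_×_)
open import Data.Product using (_,_)
open Corollary using (jₙ₊₂-Δ²ℓₙ→0; ℓₙ-weighted-sum→0)

corollary3p15 : (k : ℕ) →
    TendsToZero (λ m → jₙ₊₂ m (+ k)
                        - ((((+ 4) Data.Rational./ 1) * ℓₙ (2 Data.Nat.+ m) (+ k)
                           - ((+ 4) Data.Rational./ 1) * ℓₙ (2 Data.Nat.+ m) ((+ k) ℤ.- (+ 2)))
                           + ℓₙ (2 Data.Nat.+ m) ((+ k) ℤ.- (+ 4))))
    × TendsToZero (λ m → ℓₙ (2 Data.Nat.+ m) (+ k)
                          - Σ≤ k (λ i → weight i * jₙ₊₂ m ((+ k) ℤ.- (+ (2 Data.Nat.* i)))))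
corollary3p15 k = jₙ₊₂-Δ²ℓₙ→0 k , ℓₙ-weighted-sum→0 k
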